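{- There exists an algorithm that takes as input an instance of MinAvgSTC on $m=2$ machines in which all jobs have unit weight, with $K$ scenarios and jobs labelled $1,\dots,n$ in an arbitrary fixed order, together with an optimal solution of this instance, and outputs an optimal solution $\varphi$ whose full disbalance \[ \max_{j\in[n],\,k\in[K]}\Big\{\max_{i\in\{1,2\}}|\{j'\in J_i\cap S_k: j'\le j\}|-\min_{i\in\{1,2\}}|\{j'\in J_i\cap S_k: j'\le j\}|\Big\} \] is at most \[ \left(2^{2^{K+1}}\cdot (K!)^2+1\right)^{2\cdot 2^K}\cdot 2^{2^{K+1}+K+1}\cdot (K!)^2+\sqrt{K}\cdot 2^{K-1}. \]
   Context: An instance consists of jobs $[n]$, machines $[m]$, scenarios $S_1,\dots,S_K\subseteq[n]$ and weights $w_j$. A solution is an assignment $\varphi:[n]\to[m]$; write $J_i=\varphi^{ -1}(i)$. With unit weights, the cost of $\varphi$ in scenario $k$ is $G(\varphi,k)=\sum_{i=1}^m \tfrac12|J_i\cap S_k|(|J_i\cap S_k|+1)$. MinAvgSTC asks to minimize $\sum_{k=1}^K G(\varphi,k)$; an optimal solution is an assignment minimizing this quantity. -}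

module Defs where

open import Data.Nat using (ℕ; zero; suc; _+_; _*_; _∸_; _^_; _≤_; _⊔_; _⊓_; _!)
open import Data.Nat.DivMod using (_/_)
open import Data.Fin using (Fin; _≤?_)
open import Data.Fin.Properties using (_≟_)
open import Data.Fin.Subset using (Subset; _∩_; ∣_∣)
open import Data.Vec using (tabulate)
open import Data.List using (List; map; foldr)
open import Data.List.Base using (allFin)
open import Data.Bool using (Bool; true; false)
open import Relation.Nullary.Decidable using (isYes)

-- Instance of MinAvgSTC with m = 2 machines, unit weights:
-- jobs Fin n (labelled in their natural order), machines Fin 2,
-- K scenarios S : Fin K → Subset n.
Scenarios : ℕ → ℕ → Set
Scenarios n K = Fin K → Subset n

Assignment : ℕ → Set
Assignment n = Fin n → Fin 2

sumFin : (k : ℕ) → (Fin k → ℕ) → ℕ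
sumFin k f = foldr _+_ 0 (map f (allFin k))

-- max_{x ∈ Fin k} f x  (0 for an empty range)
maxFin : (k : ℕ) → (Fin k → ℕ) → ℕ
maxFin k f = foldr _⊔_ 0 (map f (allFin k))

machineJobs : {n : ℕ} → Assignment n → Fin 2 → Subset n
machineJobs φ i = tabulate (λ j → isYes (φ j ≟ i))

prefix : {n : ℕ} → Fin n → Subset n
prefix j = tabulate (λ j' → isYes (j' ≤? j))

G : {n K : ℕ} → Scenarios n K → Assignment n → Fin K → ℕ
G S φ k = sumFin 2 (λ i → let c = ∣ machineJobs φ i ∩ S k ∣ in (c * (c + 1)) / 2)

totalCost : {n K : ℕ} → Scenarios n K → Assignment n → ℕ
totalCost {n} {K} S φ = sumFin K (G S φ)

IsOptimal : {n K : ℕ} → Scenarios n K → Assignment n → Set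
IsOptimal {n} S φ = (ψ : Assignment n) → totalCost S φ ≤ totalCost S ψ

prefixLoad : {n K : ℕ} → Scenarios n K → Assignment n → Fin n → Fin K → Fin 2 → ℕ
prefixLoad S φ j k i = ∣ (machineJobs φ i ∩ S k) ∩ prefix j ∣

fullDisbalance : {n K : ℕ} → Scenarios n K → Assignment n → ℕ
fullDisbalance {n} {K} S φ =
  maxFin n (λ j → maxFin K (λ k →
    (prefixLoad S φ j k Fin.zero ⊔ prefixLoad S φ j k (Fin.suc Fin.zero))
    ∸ (prefixLoad S φ j k Fin.zero ⊓ prefixLoad S φ j k (Fin.suc Fin.zero))))
  where import Data.Fin as Fin

boundMain : ℕ → ℕ
boundMain K =
  ((2 ^ (2 ^ (K + 1)) * ((K !) * (K !)) + 1) ^ (2 * 2 ^ K))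
    * 2 ^ (2 ^ (K + 1) + K + 1) * ((K !) * (K !))

-- For natural d:  d ≤ A(K) + √K · 2^{K-1}
--   ⇔  (d ∸ A(K))² ≤ (√K · 2^{K-1})² = K · 4^{K-1}
-- (for K = 0 the right side is 0, matching √0 · 2^{-1} = 0).
WithinBound : ℕ → ℕ → Set
WithinBound K d = (d ∸ boundMain K) * (d ∸ boundMain K) ≤ K * 4 ^ (K ∸ 1)

-- On two machines the cost of scenario k is (s² + 2s + D_k²)/4 with s = |S_k| and
-- D_k = |J₀ ∩ S_k| - |J₁ ∩ S_k|, so every assignment with the discrepancies D of the given optimum
-- is optimal.  Group the jobs by type, the set of scenarios containing them: D_k is the sum of the
-- signed per-type imbalances over the types containing k.  Comparison with the assignment that
-- alternates within every type gives |D_k| ≤ K 4^K.  Half of each type's imbalance, viewed as a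
-- multiset of signed 0/1-vectors with bounded sum, splits into a zero-sum part and a part of bounded
-- size (coordinate by coordinate, cutting out short zero-sum blocks by pigeonhole on balanced
-- prefix sums).  Moving the jobs of the zero-sum part to the lighter machine keeps every D_k and
-- leaves bounded imbalances; putting each type's remaining imbalance first and then alternating
-- bounds every prefix imbalance, hence the full disbalance.

module Submission where

open import Defs
open import Data.Nat using (ℕ)
open import Data.Product using (Σ-syntax; _×_; _,_)

module _ where

  open import Data.Nat as ℕ using (zero; suc; z≤n; s≤s)
  import Data.Nat.Properties as ℕₚ
  open import Data.Integer using (ℤ; +_; -_; _+_; _-_; _*_; ∣_∣; 0ℤ; 1ℤ; _≤_; +≤+; -≤+; -≤-; -[1+_])
  import Data.Integer.Properties as ℤₚ
  open import Data.Integer.Tactic.RingSolver using (solve-∀)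
  open import Data.Fin using (Fin)
  import Data.Fin as Fin
  open import Data.List using (List; []; _∷_; _++_; length; concat; concatMap; map; replicate; tabulate; allFin)
  open import Data.List.Membership.Propositional using (_∈_)
  open import Data.List.Relation.Unary.Any using (here; there)
  open import Data.List.Relation.Binary.Permutation.Propositional as ↭ using (_↭_)
  open import Data.List.Relation.Binary.Permutation.Propositional.Properties using (++⁺ˡ; shifts)
  open import Relation.Binary.PropositionalEquality
  open import Function using (_∘_)

  ∣i∣≤n⇒i≤n : ∀ {i n} → ∣ i ∣ ℕ.≤ n → i ≤ + n
  ∣i∣≤n⇒i≤n {+ m} m≤n = +≤+ m≤n
  ∣i∣≤n⇒i≤n { -[1+ m ]} _ = -≤+

  ∣i∣≤n⇒-n≤i : ∀ {i n} → ∣ i ∣ ℕ.≤ n → - + n ≤ i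
  ∣i∣≤n⇒-n≤i {+ m} _ = ℤₚ.neg-≤-pos
  ∣i∣≤n⇒-n≤i { -[1+ m ]} (s≤s m≤n) = -≤- m≤n

  ∣i-j∣≤n⇒i≤j+n : ∀ {i j n} → ∣ i - j ∣ ℕ.≤ n → i ≤ j + + n
  ∣i-j∣≤n⇒i≤j+n {i} {j} {n} ∣i-j∣≤n = begin
    i             ≡⟨ lemma i j ⟩
    j + (i - j)   ≤⟨ ℤₚ.+-monoʳ-≤ j (∣i∣≤n⇒i≤n ∣i-j∣≤n) ⟩
    j + + n       ∎
    where
      open ℤₚ.≤-Reasoning
      lemma : ∀ i j → i ≡ j + (i - j)
      lemma = solve-∀

  +-cancelˡ-≤ : ∀ a {x y} → a + x ≤ a + y → x ≤ y
  +-cancelˡ-≤ a {x} {y} a+x≤a+y = subst₂ _≤_ (lemma a x) (lemma a y) (ℤₚ.+-monoˡ-≤ (- a) a+x≤a+y)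
    where lemma : ∀ a x → a + x - a ≡ x
          lemma = solve-∀

  +[m∸n]≡+m-+n : ∀ {m n} → n ℕ.≤ m → + (m ℕ.∸ n) ≡ + m - + n
  +[m∸n]≡+m-+n {m} {n} n≤m = sym (trans (ℤₚ.m-n≡m⊖n m n) (ℤₚ.⊖-≥ n≤m))

  i*i≡+∣i∣*∣i∣ : ∀ i → i * i ≡ + (∣ i ∣ ℕ.* ∣ i ∣)
  i*i≡+∣i∣*∣i∣ (+ m) = sym (ℤₚ.pos-* m m)
  i*i≡+∣i∣*∣i∣ -[1+ m ] = refl

  ∑ : {A : Set} → (A → ℤ) → List A → ℤ
  ∑ f [] = 0ℤ
  ∑ f (x ∷ xs) = f x + ∑ f xs

  module _ {A : Set} where

    ∑-cong : ∀ {f g : A → ℤ} → (∀ x → f x ≡ g x) → ∀ xs → ∑ f xs ≡ ∑ g xs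
    ∑-cong f≡g [] = refl
    ∑-cong f≡g (x ∷ xs) = cong₂ _+_ (f≡g x) (∑-cong f≡g xs)

    ∑-++ : ∀ (f : A → ℤ) xs ys → ∑ f (xs ++ ys) ≡ ∑ f xs + ∑ f ys
    ∑-++ f [] ys = sym (ℤₚ.+-identityˡ _)
    ∑-++ f (x ∷ xs) ys = trans (cong (λ s → f x + s) (∑-++ f xs ys)) (sym (ℤₚ.+-assoc (f x) _ _))

    ∑-+ : ∀ (f g : A → ℤ) xs → ∑ (λ x → f x + g x) xs ≡ ∑ f xs + ∑ g xs
    ∑-+ f g [] = refl
    ∑-+ f g (x ∷ xs) = trans (cong (λ s → f x + g x + s) (∑-+ f g xs)) (lemma (f x) (g x) _ _)
      where lemma : ∀ a b c d → a + b + (c + d) ≡ a + c + (b + d)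
            lemma = solve-∀

    ∑-*ˡ : ∀ c (f : A → ℤ) xs → ∑ (λ x → c * f x) xs ≡ c * ∑ f xs
    ∑-*ˡ c f [] = sym (ℤₚ.*-zeroʳ c)
    ∑-*ˡ c f (x ∷ xs) = trans (cong (λ s → c * f x + s) (∑-*ˡ c f xs)) (sym (ℤₚ.*-distribˡ-+ c (f x) _))

    ∑-neg : ∀ (f : A → ℤ) xs → ∑ (λ x → - f x) xs ≡ - ∑ f xs
    ∑-neg f [] = refl
    ∑-neg f (x ∷ xs) = trans (cong (λ s → - f x + s) (∑-neg f xs)) (sym (ℤₚ.neg-distrib-+ (f x) _))

    ∑-difference : ∀ (f g : A → ℤ) xs → ∑ (λ x → f x - g x) xs ≡ ∑ f xs - ∑ g xs
    ∑-difference f g xs = trans (∑-+ f (λ x → - g x) xs) (cong (λ s → ∑ f xs + s) (∑-neg g xs))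

    ∑-zero : ∀ (xs : List A) → ∑ (λ _ → 0ℤ) xs ≡ 0ℤ
    ∑-zero [] = refl
    ∑-zero (x ∷ xs) = trans (ℤₚ.+-identityˡ _) (∑-zero xs)

    ∑-replicate : ∀ (f : A → ℤ) m x → ∑ f (replicate m x) ≡ + m * f x
    ∑-replicate f zero x = refl
    ∑-replicate f (suc m) x = trans (cong (λ s → f x + s) (∑-replicate f m x)) (lemma (f x) (+ m))
      where lemma : ∀ c l → c + l * c ≡ (1ℤ + l) * c
            lemma = solve-∀

    ∑-↭ : ∀ (f : A → ℤ) {xs ys} → xs ↭ ys → ∑ f xs ≡ ∑ f ys
    ∑-↭ f ↭.refl = refl
    ∑-↭ f (↭.prep x p) = cong (λ s → f x + s) (∑-↭ f p)
    ∑-↭ f (↭.swap x y p) = trans (lemma (f x) (f y) _) (cong (λ s → f y + (f x + s)) (∑-↭ f p))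
      where lemma : ∀ a b c → a + (b + c) ≡ b + (a + c)
            lemma = solve-∀
    ∑-↭ f (↭.trans p q) = trans (∑-↭ f p) (∑-↭ f q)

    ∣∑∣≤ : ∀ (f : A → ℤ) M → (∀ x → ∣ f x ∣ ℕ.≤ M) → ∀ xs → ∣ ∑ f xs ∣ ℕ.≤ length xs ℕ.* M
    ∣∑∣≤ f M ∣f∣≤M [] = z≤n
    ∣∑∣≤ f M ∣f∣≤M (x ∷ xs) =
      ℕₚ.≤-trans (ℤₚ.∣i+j∣≤∣i∣+∣j∣ (f x) (∑ f xs)) (ℕₚ.+-mono-≤ (∣f∣≤M x) (∣∑∣≤ f M ∣f∣≤M xs))

    ∑-nonneg : ∀ (f : A → ℤ) → (∀ x → 0ℤ ≤ f x) → ∀ xs → 0ℤ ≤ ∑ f xs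
    ∑-nonneg f 0≤f [] = ℤₚ.≤-refl
    ∑-nonneg f 0≤f (x ∷ xs) = ℤₚ.+-mono-≤ (0≤f x) (∑-nonneg f 0≤f xs)

    term≤∑ : ∀ (f : A → ℤ) → (∀ x → 0ℤ ≤ f x) → ∀ {x xs} → x ∈ xs → f x ≤ ∑ f xs
    term≤∑ f 0≤f {x} {_ ∷ xs} (here refl) =
      ℤₚ.≤-trans (ℤₚ.≤-reflexive (sym (ℤₚ.+-identityʳ (f x)))) (ℤₚ.+-monoʳ-≤ (f x) (∑-nonneg f 0≤f xs))
    term≤∑ f 0≤f {x} {y ∷ xs} (there x∈xs) =
      ℤₚ.≤-trans (term≤∑ f 0≤f x∈xs) (ℤₚ.≤-trans (ℤₚ.≤-reflexive (sym (ℤₚ.+-identityˡ _))) (ℤₚ.+-monoˡ-≤ (∑ f xs) (0≤f y)))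

  ∑-map : ∀ {A B : Set} (f : B → ℤ) (g : A → B) xs → ∑ f (map g xs) ≡ ∑ (f ∘ g) xs
  ∑-map f g [] = refl
  ∑-map f g (x ∷ xs) = cong (λ s → f (g x) + s) (∑-map f g xs)

  ∑-concatMap : ∀ {A B : Set} (f : A → ℤ) (g : B → List A) xs → ∑ f (concatMap g xs) ≡ ∑ (λ x → ∑ f (g x)) xs
  ∑-concatMap f g [] = refl
  ∑-concatMap f g (x ∷ xs) = trans (∑-++ f (g x) (concatMap g xs)) (cong (λ s → ∑ f (g x) + s) (∑-concatMap f g xs))

  ∑-comm : ∀ {A B : Set} (g : A → B → ℤ) xs ys → ∑ (λ x → ∑ (g x) ys) xs ≡ ∑ (λ y → ∑ (λ x → g x y) xs) ys
  ∑-comm g [] ys = sym (∑-zero ys)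
  ∑-comm g (x ∷ xs) ys =
    trans (cong (λ s → ∑ (g x) ys + s) (∑-comm g xs ys)) (sym (∑-+ (g x) (λ y → ∑ (λ x → g x y) xs) ys))

  ∑-allFin-suc : ∀ {n} (f : Fin (suc n) → ℤ) → ∑ f (allFin (suc n)) ≡ f Fin.zero + ∑ (f ∘ Fin.suc) (allFin n)
  ∑-allFin-suc {n} f = cong (λ s → f Fin.zero + s) (∑-tabulate f Fin.suc)
    where
      ∑-tabulate : ∀ {A : Set} {n} (f : A → ℤ) (g : Fin n → A) → ∑ f (tabulate g) ≡ ∑ (f ∘ g) (allFin n)
      ∑-tabulate {n = zero} f g = refl
      ∑-tabulate {n = suc n} f g =
        cong (λ s → f (g Fin.zero) + s) (trans (∑-tabulate f (g ∘ Fin.suc)) (sym (∑-tabulate (f ∘ g) Fin.suc)))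

  concat⁺ : ∀ {A : Set} {xss yss : List (List A)} → xss ↭ yss → concat xss ↭ concat yss
  concat⁺ ↭.refl = ↭.refl
  concat⁺ (↭.prep xs p) = ++⁺ˡ xs (concat⁺ p)
  concat⁺ (↭.swap xs ys p) = ↭.trans (shifts xs ys) (++⁺ˡ ys (++⁺ˡ xs (concat⁺ p)))
  concat⁺ (↭.trans p q) = ↭.trans (concat⁺ p) (concat⁺ q)

-- Zero-sum decompositions
module _ where

  open import Data.Nat as ℕ using (ℕ; zero; suc; z≤n; s≤s)
  import Data.Nat.Properties as ℕₚ
  open import Data.Nat.Induction using (<-wellFounded)
  open import Induction.WellFounded using (Acc; acc)
  open import Data.Integer using (ℤ; +_; -_; _+_; _-_; _*_; ∣_∣; 0ℤ; 1ℤ; -1ℤ; _≤_; _<_; +≤+; -≤+; -≤-; +[1+_]; -[1+_])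
  import Data.Integer.Properties as ℤₚ
  open import Algebra.Properties.AbelianGroup ℤₚ.+-0-abelianGroup using () renaming (∙-cancelˡ to +-cancelˡ)
  open import Data.Integer.Tactic.RingSolver using (solve-∀)
  open import Data.Fin using (Fin; toℕ; fromℕ<)
  import Data.Fin
  import Data.Fin.Properties as Finₚ
  open import Data.List using (List; []; _∷_; _++_; length; concatMap; take; drop)
  import Data.List.Properties as Listₚ
  open import Data.List.Relation.Unary.All using (All; []; _∷_)
  open import Data.List.Relation.Binary.Permutation.Propositional
    using (_↭_; prep; ↭-sym; ↭-refl; ↭-reflexive; ↭-trans; module PermutationReasoning)
  open import Data.List.Relation.Binary.Permutation.Propositional.Properties
    using (shift; shifts; ++⁺ˡ; ++⁺ʳ; ↭-length; map⁺)
  open import Data.Product using (Σ-syntax; ∃; ∃₂; _×_; _,_; proj₁; proj₂)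
  open import Relation.Binary.PropositionalEquality
  open import Relation.Nullary using (yes; no)
  open import Data.Empty using (⊥-elim)

  pigeonhole-window : ∀ N a (Q : ℕ → ℤ) → (∀ i → i ℕ.≤ suc N → a ≤ Q i × Q i ≤ a + + N) →
                      ∃₂ λ i j → i ℕ.< j × j ℕ.≤ suc N × Q i ≡ Q j
  pigeonhole-window N a Q window = collision (Finₚ.pigeonhole (ℕₚ.n<1+n (suc N)) slot)
    where
      bound : ∀ (i : Fin (suc (suc N))) → toℕ i ℕ.≤ suc N
      bound i = ℕₚ.<⇒≤pred (Finₚ.toℕ<n i)
      offset : ∀ i → i ℕ.≤ suc N → ∃ λ (c : Fin (suc N)) → Q i ≡ a + + toℕ c
      offset i i≤ = fromInterval (Q i - a) (ℤₚ.i≤j⇒0≤j-i a≤Q) Q-a≤N (lemma (Q i) a)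
        where
          a≤Q = proj₁ (window i i≤)
          Q-a≤N : Q i - a ≤ + N
          Q-a≤N = ℤₚ.≤-trans (ℤₚ.+-monoˡ-≤ (- a) (proj₂ (window i i≤))) (ℤₚ.≤-reflexive (lemma′ a (+ N)))
            where lemma′ : ∀ a n → a + n - a ≡ n
                  lemma′ = solve-∀
          lemma : ∀ q a → q ≡ a + (q - a)
          lemma = solve-∀
          fromInterval : ∀ d → 0ℤ ≤ d → d ≤ + N → Q i ≡ a + d → ∃ λ (c : Fin (suc N)) → Q i ≡ a + + toℕ c
          fromInterval (+ c) _ (+≤+ c≤N) eq =
            fromℕ< (s≤s c≤N) , trans eq (cong (λ c → a + + c) (sym (Finₚ.toℕ-fromℕ< (s≤s c≤N))))
      slot : Fin (suc (suc N)) → Fin (suc N)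
      slot i = proj₁ (offset (toℕ i) (bound i))
      collision : (∃₂ λ i j → i Data.Fin.< j × slot i ≡ slot j) → ∃₂ λ i j → i ℕ.< j × j ℕ.≤ suc N × Q i ≡ Q j
      collision (i , j , i<j , same) =
        toℕ i , toℕ j , i<j , bound j ,
        trans (proj₂ (offset (toℕ i) (bound i))) (trans (cong (λ c → a + + toℕ c) same) (sym (proj₂ (offset (toℕ j) (bound j)))))

  take≡take++segment : ∀ {A : Set} {i j} → i ℕ.≤ j → (ys : List A) → take j ys ≡ take i ys ++ drop i (take j ys)
  take≡take++segment {i = i} {j} i≤j ys = begin
    take j ys                                       ≡⟨ Listₚ.take++drop≡id i (take j ys) ⟨
    take i (take j ys) ++ drop i (take j ys)        ≡⟨ cong (_++ drop i (take j ys)) (Listₚ.take-take i j ys) ⟩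
    take (i ℕ.⊓ j) ys ++ drop i (take j ys)         ≡⟨ cong (λ k → take k ys ++ drop i (take j ys)) (ℕₚ.m≤n⇒m⊓n≡m i≤j) ⟩
    take i ys ++ drop i (take j ys)                 ∎
    where open ≡-Reasoning

  segment-↭ : ∀ {A : Set} {i j} → i ℕ.≤ j → (ys : List A) → ys ↭ drop i (take j ys) ++ (take i ys ++ drop j ys)
  segment-↭ {i = i} {j} i≤j ys = begin
    ys                                                  ≡⟨ Listₚ.take++drop≡id j ys ⟨
    take j ys ++ drop j ys                              ≡⟨ cong (_++ drop j ys) (take≡take++segment i≤j ys) ⟩
    (take i ys ++ drop i (take j ys)) ++ drop j ys      ≡⟨ Listₚ.++-assoc (take i ys) _ _ ⟩
    take i ys ++ drop i (take j ys) ++ drop j ys        ↭⟨ shifts (take i ys) (drop i (take j ys)) ⟩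
    drop i (take j ys) ++ take i ys ++ drop j ys        ∎
    where open PermutationReasoning

  blockWidth : ℕ → ℕ
  blockWidth M = suc (2 ℕ.* M)

  -- For values in [-M, M] and ∣∑∣ ≤ C, a list longer than this contains a short zero-sum block.
  leftover : ℕ → ℕ → ℕ
  leftover M C = 2 ℕ.* M ℕ.+ 2 ℕ.* M ℕ.* M ℕ.+ C

  module ShortZeroSumBlocks {A : Set} (h : A → ℤ) (M : ℕ) (∣h∣≤M : ∀ x → ∣ h x ∣ ℕ.≤ M) where

    Positive Negative : A → Set
    Positive x = 1ℤ ≤ h x
    Negative x = h x ≤ -1ℤ

    record SignSplit (xs : List A) : Set where
      field
        zeros positives negatives : List A
        perm : xs ↭ zeros ++ positives ++ negatives
        all-zero : All (λ x → h x ≡ 0ℤ) zeros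
        all-positive : All Positive positives
        all-negative : All Negative negatives

    splitBySign : ∀ xs → SignSplit xs
    splitBySign [] = record
      { zeros = [] ; positives = [] ; negatives = [] ; perm = ↭-refl
      ; all-zero = [] ; all-positive = [] ; all-negative = [] }
    splitBySign (x ∷ xs) with splitBySign xs | h x in hx
    ... | r | + zero = record
      { zeros = x ∷ zeros ; positives = positives ; negatives = negatives ; perm = prep x perm
      ; all-zero = hx ∷ all-zero ; all-positive = all-positive ; all-negative = all-negative }
      where open SignSplit r
    ... | r | +[1+ _ ] = record
      { zeros = zeros ; positives = x ∷ positives ; negatives = negatives
      ; perm = ↭-trans (prep x perm) (↭-sym (shift x zeros (positives ++ negatives)))
      ; all-zero = all-zero ; all-positive = subst (1ℤ ≤_) (sym hx) (+≤+ (s≤s z≤n)) ∷ all-positive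
      ; all-negative = all-negative }
      where open SignSplit r
    ... | r | -[1+ _ ] = record
      { zeros = zeros ; positives = positives ; negatives = x ∷ negatives
      ; perm = begin
          x ∷ xs                                     <⟨ perm ⟩
          x ∷ zeros ++ positives ++ negatives        ≡⟨ cong (x ∷_) (Listₚ.++-assoc zeros positives negatives) ⟨
          x ∷ (zeros ++ positives) ++ negatives      ↭⟨ shift x (zeros ++ positives) negatives ⟨
          (zeros ++ positives) ++ x ∷ negatives      ≡⟨ Listₚ.++-assoc zeros positives (x ∷ negatives) ⟩
          zeros ++ positives ++ x ∷ negatives        ∎
      ; all-zero = all-zero ; all-positive = all-positive
      ; all-negative = subst (_≤ -1ℤ) (sym hx) (-≤- z≤n) ∷ all-negative }
      where
        open SignSplit r
        open PermutationReasoning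

    Balanced : ℤ → Set
    Balanced s = - + M ≤ s × s ≤ + M

    balanced-+positive : ∀ {s x} → Balanced s → s ≤ 0ℤ → Positive x → Balanced (s + h x)
    balanced-+positive {s} {x} (-M≤s , _) s≤0 1≤hx = lower , upper
      where
        open ℤₚ.≤-Reasoning
        lower = begin
          - + M        ≤⟨ -M≤s ⟩
          s            ≡⟨ ℤₚ.+-identityʳ s ⟨
          s + 0ℤ       ≤⟨ ℤₚ.+-monoʳ-≤ s (ℤₚ.≤-trans (+≤+ z≤n) 1≤hx) ⟩
          s + h x      ∎
        upper = begin
          s + h x      ≤⟨ ℤₚ.+-mono-≤ s≤0 (∣i∣≤n⇒i≤n (∣h∣≤M x)) ⟩
          0ℤ + + M     ≡⟨ ℤₚ.+-identityˡ (+ M) ⟩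
          + M          ∎

    balanced-+negative : ∀ {s x} → Balanced s → 0ℤ < s → Negative x → Balanced (s + h x)
    balanced-+negative {s} {x} (_ , s≤M) 0<s hx≤-1 = lower , upper
      where
        open ℤₚ.≤-Reasoning
        lower = begin
          - + M        ≡⟨ ℤₚ.+-identityˡ (- + M) ⟨
          0ℤ + - + M   ≤⟨ ℤₚ.+-mono-≤ (ℤₚ.<⇒≤ 0<s) (∣i∣≤n⇒-n≤i (∣h∣≤M x)) ⟩
          s + h x      ∎
        upper = begin
          s + h x      ≤⟨ ℤₚ.+-monoʳ-≤ s (ℤₚ.≤-trans hx≤-1 -≤+) ⟩
          s + 0ℤ       ≡⟨ ℤₚ.+-identityʳ s ⟩
          s            ≤⟨ s≤M ⟩
          + M          ∎

    record Interleaving (k : ℕ) (s : ℤ) (ps ns : List A) : Set where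
      field
        ys rest : List A
        perm : ps ++ ns ↭ ys ++ rest
        length-ys : length ys ≡ k
        balanced : ∀ i → i ℕ.≤ k → Balanced (s + ∑ h (take i ys))

    extend : ∀ {k s ps ns ps′ ns′} x → ps ++ ns ↭ x ∷ ps′ ++ ns′ → Balanced s →
             Interleaving k (s + h x) ps′ ns′ → Interleaving (suc k) s ps ns
    extend {s = s} x p b r = record
      { ys = x ∷ ys ; rest = rest ; perm = ↭-trans p (prep x perm) ; length-ys = cong suc length-ys
      ; balanced = λ { zero _ → subst Balanced (sym (ℤₚ.+-identityʳ s)) b
                     ; (suc i) (s≤s i≤k) → subst Balanced (ℤₚ.+-assoc s (h x) _) (balanced i i≤k) } }
      where open Interleaving r

    -- Taking a positive element while the running sum is ≤ 0 and a negative one otherwise keeps every prefix sum in [-M, M].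
    interleave : ∀ k s {ps ns} → All Positive ps → All Negative ns → k ℕ.≤ length ps → k ℕ.≤ length ns →
                 Balanced s → Interleaving k s ps ns
    interleave zero s {ps} {ns} _ _ _ _ b = record
      { ys = [] ; rest = ps ++ ns ; perm = ↭-refl ; length-ys = refl
      ; balanced = λ { zero _ → subst Balanced (sym (ℤₚ.+-identityʳ s)) b } }
    interleave (suc k) s ap an k<ps k<ns b with s ℤₚ.≤? 0ℤ
    interleave (suc k) s {p ∷ ps} (p⁺ ∷ ap) an (s≤s k≤ps) k<ns b | yes s≤0 =
      extend p ↭-refl b (interleave k _ ap an k≤ps (ℕₚ.≤-trans (ℕₚ.n≤1+n k) k<ns) (balanced-+positive b s≤0 p⁺))
    interleave (suc k) s {ps} {q ∷ ns} ap (q⁻ ∷ an) k<ps (s≤s k≤ns) b | no s≰0 =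
      extend q (shift q ps ns) b
        (interleave k _ ap an (ℕₚ.≤-trans (ℕₚ.n≤1+n k) k<ps) k≤ns (balanced-+negative b (ℤₚ.≰⇒> s≰0) q⁻))

    record ZeroSumBlock (xs : List A) : Set where
      field
        block rest : List A
        perm : xs ↭ block ++ rest
        zero-sum : ∑ h block ≡ 0ℤ
        nonempty : 0 ℕ.< length block
        short : length block ℕ.≤ blockWidth M

    -- Two equal prefix sums of a balanced interleaving delimit a zero-sum block.
    blockOfInterleaving : ∀ {ps ns} → Interleaving (blockWidth M) 0ℤ ps ns → ZeroSumBlock (ps ++ ns)
    blockOfInterleaving {ps} {ns} I = record
      { block = drop i (take j ys) ; rest = (take i ys ++ drop j ys) ++ rest
      ; perm = perm′
      ; zero-sum = zero-sum
      ; nonempty = subst (0 ℕ.<_) (sym length-block) (ℕₚ.m<n⇒0<n∸m i<j)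
      ; short = subst (ℕ._≤ blockWidth M) (sym length-block) (ℕₚ.≤-trans (ℕₚ.m∸n≤m j i) j≤w) }
      where
        open Interleaving I
        Q : ℕ → ℤ
        Q i = ∑ h (take i ys)
        window : ∀ i → i ℕ.≤ blockWidth M → - + M ≤ Q i × Q i ≤ - + M + + (2 ℕ.* M)
        window i i≤w with subst Balanced (ℤₚ.+-identityˡ (Q i)) (balanced i i≤w)
        ... | -M≤Q , Q≤M = -M≤Q , ℤₚ.≤-trans Q≤M (ℤₚ.≤-reflexive (sym centre))
          where
            centre : - + M + + (2 ℕ.* M) ≡ + M
            centre = trans (cong (λ t → - + M + t) (ℤₚ.pos-* 2 M)) (lemma (+ M))
              where lemma : ∀ m → - m + + 2 * m ≡ m
                    lemma = solve-∀
        collision = pigeonhole-window (2 ℕ.* M) (- + M) Q window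
        i = proj₁ collision
        j = proj₁ (proj₂ collision)
        i<j = proj₁ (proj₂ (proj₂ collision))
        j≤w = proj₁ (proj₂ (proj₂ (proj₂ collision)))
        Qi≡Qj = proj₂ (proj₂ (proj₂ (proj₂ collision)))
        i≤j = ℕₚ.<⇒≤ i<j
        zero-sum : ∑ h (drop i (take j ys)) ≡ 0ℤ
        zero-sum = +-cancelˡ (Q i) _ _ (begin
          Q i + ∑ h (drop i (take j ys))         ≡⟨ ∑-++ h (take i ys) _ ⟨
          ∑ h (take i ys ++ drop i (take j ys))  ≡⟨ cong (∑ h) (take≡take++segment i≤j ys) ⟨
          Q j                                    ≡⟨ Qi≡Qj ⟨
          Q i                                    ≡⟨ ℤₚ.+-identityʳ (Q i) ⟨
          Q i + 0ℤ                               ∎)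
          where open ≡-Reasoning
        perm′ : ps ++ ns ↭ drop i (take j ys) ++ (take i ys ++ drop j ys) ++ rest
        perm′ = begin
          ps ++ ns                                               ↭⟨ perm ⟩
          ys ++ rest                                             ↭⟨ ++⁺ʳ rest (segment-↭ i≤j ys) ⟩
          (drop i (take j ys) ++ take i ys ++ drop j ys) ++ rest ≡⟨ Listₚ.++-assoc (drop i (take j ys)) _ rest ⟩
          drop i (take j ys) ++ (take i ys ++ drop j ys) ++ rest ∎
          where open PermutationReasoning
        length-block : length (drop i (take j ys)) ≡ j ℕ.∸ i
        length-block = trans (Listₚ.length-drop i (take j ys))
          (cong (ℕ._∸ i) (trans (Listₚ.length-take j ys) (trans (cong (j ℕ.⊓_) length-ys) (ℕₚ.m≤n⇒m⊓n≡m j≤w))))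

    positives-count : ∀ {ps} → All Positive ps → + length ps ≤ ∑ h ps
    positives-count [] = ℤₚ.≤-refl
    positives-count (p⁺ ∷ ap) = ℤₚ.+-mono-≤ p⁺ (positives-count ap)

    negatives-count : ∀ {ns} → All Negative ns → + length ns ≤ - ∑ h ns
    negatives-count [] = ℤₚ.≤-refl
    negatives-count {q ∷ ns} (q⁻ ∷ an) = ℤₚ.≤-trans (ℤₚ.+-mono-≤ (ℤₚ.neg-mono-≤ q⁻) (negatives-count an))
                                                    (ℤₚ.≤-reflexive (sym (ℤₚ.neg-distrib-+ (h q) (∑ h ns))))

    ∑≤length*M : ∀ xs → ∑ h xs ≤ + (length xs ℕ.* M)
    ∑≤length*M xs = ∣i∣≤n⇒i≤n (∣∑∣≤ h M ∣h∣≤M xs)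

    -∑≤length*M : ∀ xs → - ∑ h xs ≤ + (length xs ℕ.* M)
    -∑≤length*M xs = ∣i∣≤n⇒i≤n (subst (ℕ._≤ length xs ℕ.* M) (sym (ℤₚ.∣-i∣≡∣i∣ (∑ h xs))) (∣∑∣≤ h M ∣h∣≤M xs))

    -- a elements of one sign, b of the other: if a is small, so is b, since the sums nearly cancel.
    few⇒short : ∀ {a b C} {P N : ℤ} → a ℕ.≤ 2 ℕ.* M → + b ≤ N → P ≤ + (a ℕ.* M) → N ≤ P + + C →
                a ℕ.+ b ℕ.≤ leftover M C
    few⇒short {a} {b} {C} {P} {N} a≤2M b≤N P≤aM N≤P+C = begin
      a ℕ.+ b                            ≤⟨ ℕₚ.+-mono-≤ a≤2M (ℕₚ.≤-trans b≤aM+C (ℕₚ.+-monoˡ-≤ C (ℕₚ.*-monoˡ-≤ M a≤2M))) ⟩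
      2 ℕ.* M ℕ.+ (2 ℕ.* M ℕ.* M ℕ.+ C)  ≡⟨ ℕₚ.+-assoc (2 ℕ.* M) _ C ⟨
      leftover M C                         ∎
      where
        open ℕₚ.≤-Reasoning
        b≤aM+C : b ℕ.≤ a ℕ.* M ℕ.+ C
        b≤aM+C = ℤₚ.drop‿+≤+ (ℤₚ.≤-trans b≤N (ℤₚ.≤-trans N≤P+C
                   (ℤₚ.≤-trans (ℤₚ.+-monoˡ-≤ (+ C) P≤aM) (ℤₚ.≤-reflexive (sym (ℤₚ.pos-+ (a ℕ.* M) C))))))

    shortZeroSumBlock : ∀ {C} xs → ∣ ∑ h xs ∣ ℕ.≤ C → leftover M C ℕ.< length xs → ZeroSumBlock xs
    shortZeroSumBlock xs ∣∑∣≤C long with splitBySign xs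
    ... | record { zeros = z ∷ zs ; positives = ps ; negatives = ns ; perm = p ; all-zero = hz≡0 ∷ _ } = record
      { block = z ∷ [] ; rest = zs ++ ps ++ ns ; perm = p
      ; zero-sum = trans (ℤₚ.+-identityʳ (h z)) hz≡0 ; nonempty = s≤s z≤n ; short = s≤s z≤n }
    ... | record { zeros = [] ; positives = ps ; negatives = ns ; perm = p ; all-positive = ap ; all-negative = an } = record
      { block = block ; rest = rest ; perm = ↭-trans p perm
      ; zero-sum = zero-sum ; nonempty = nonempty ; short = short }
      where
        P N : ℤ
        P = ∑ h ps
        N = - ∑ h ns
        ∑≡P-N : ∑ h xs ≡ P - N
        ∑≡P-N = trans (∑-↭ h p) (trans (∑-++ h ps ns) (lemma P (∑ h ns)))
          where lemma : ∀ p n → p + n ≡ p - (- n)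
                lemma = solve-∀
        P≤N+C : P ≤ N + + _
        P≤N+C = ∣i-j∣≤n⇒i≤j+n (subst (λ s → ∣ s ∣ ℕ.≤ _) ∑≡P-N ∣∑∣≤C)
        N≤P+C : N ≤ P + + _
        N≤P+C = ∣i-j∣≤n⇒i≤j+n (subst (ℕ._≤ _) (trans (cong ∣_∣ ∑≡P-N) (ℤₚ.∣i-j∣≡∣j-i∣ P N)) ∣∑∣≤C)
        length≡ : length xs ≡ length ps ℕ.+ length ns
        length≡ = trans (↭-length p) (Listₚ.length-++ ps)
        enough-ps : blockWidth M ℕ.≤ length ps
        enough-ps with blockWidth M ℕ.≤? length ps
        ... | yes w≤ = w≤
        ... | no w≰ = ⊥-elim (ℕₚ.<⇒≱ long (subst (ℕ._≤ _) (sym length≡)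
                (few⇒short (ℕₚ.≤-pred (ℕₚ.≰⇒> w≰)) (negatives-count an) (∑≤length*M ps) N≤P+C)))
        enough-ns : blockWidth M ℕ.≤ length ns
        enough-ns with blockWidth M ℕ.≤? length ns
        ... | yes w≤ = w≤
        ... | no w≰ = ⊥-elim (ℕₚ.<⇒≱ long (subst (ℕ._≤ _) (trans (ℕₚ.+-comm (length ns) (length ps)) (sym length≡))
                (few⇒short (ℕₚ.≤-pred (ℕₚ.≰⇒> w≰)) (positives-count ap) (-∑≤length*M ns) P≤N+C)))
        open ZeroSumBlock (blockOfInterleaving (interleave (blockWidth M) 0ℤ ap an enough-ps enough-ns (ℤₚ.neg-≤-pos , +≤+ z≤n)))

    ShortZeroSumBlock : Set
    ShortZeroSumBlock = Σ[ b ∈ List A ] ∑ h b ≡ 0ℤ × length b ℕ.≤ blockWidth M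

    record BlockDecomposition (C : ℕ) (xs : List A) : Set where
      field
        blocks : List ShortZeroSumBlock
        rest : List A
        perm : xs ↭ concatMap proj₁ blocks ++ rest
        small-rest : length rest ℕ.≤ leftover M C

    decompose : ∀ {C} xs → ∣ ∑ h xs ∣ ℕ.≤ C → BlockDecomposition C xs
    decompose xs = go xs (<-wellFounded (length xs))
      where
        go : ∀ {C} xs → Acc ℕ._<_ (length xs) → ∣ ∑ h xs ∣ ℕ.≤ C → BlockDecomposition C xs
        go {C} xs (acc smaller) ∣∑∣≤C with leftover M C ℕₚ.<? length xs
        ... | no ≯ = record
          { blocks = [] ; rest = xs ; perm = ↭-refl ; small-rest = ℕₚ.≮⇒≥ ≯ }
        ... | yes long = record
          { blocks = (block , zero-sum , B.short) ∷ blocks ; rest = rest′ ; perm = perm′ ; small-rest = small-rest }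
          where
            module B = ZeroSumBlock (shortZeroSumBlock xs ∣∑∣≤C long)
            open B using (block; zero-sum; nonempty)
            ∑-rest : ∑ h B.rest ≡ ∑ h xs
            ∑-rest = sym (trans (∑-↭ h B.perm) (trans (∑-++ h block B.rest)
                       (trans (cong (_+ ∑ h B.rest) zero-sum) (ℤₚ.+-identityˡ _))))
            rest<xs : length B.rest ℕ.< length xs
            rest<xs = subst (length B.rest ℕ.<_) (sym (trans (↭-length B.perm) (Listₚ.length-++ block)))
                        (ℕₚ.m<n+m (length B.rest) nonempty)
            open BlockDecomposition (go B.rest (smaller rest<xs) (subst (λ s → ∣ s ∣ ℕ.≤ C) (sym ∑-rest) ∣∑∣≤C))
              renaming (rest to rest′)
            perm′ : xs ↭ (block ++ concatMap proj₁ blocks) ++ rest′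
            perm′ = ↭-trans B.perm (↭-trans (++⁺ˡ block perm) (↭-reflexive (sym (Listₚ.++-assoc block _ rest′))))


  length-concatMap≤ : ∀ {A B : Set} {W} (g : B → List A) → (∀ x → length (g x) ℕ.≤ W) → ∀ xs →
                      length (concatMap g xs) ℕ.≤ length xs ℕ.* W
  length-concatMap≤ g ≤W [] = z≤n
  length-concatMap≤ g ≤W (x ∷ xs) =
    ℕₚ.≤-trans (ℕₚ.≤-reflexive (Listₚ.length-++ (g x))) (ℕₚ.+-mono-≤ (≤W x) (length-concatMap≤ g ≤W xs))

  decompositionBound : ℕ → ℕ → ℕ → ℕ
  decompositionBound zero M C = 0
  decompositionBound (suc d) M C =
    blockWidth M ℕ.* decompositionBound d (blockWidth M ℕ.* M) (C ℕ.+ leftover M C ℕ.* M) ℕ.+ leftover M C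

  record ZeroSumDecomposition {A : Set} {d} (v : A → Fin d → ℤ) (B : ℕ) (xs : List A) : Set where
    field
      zeroPart rest : List A
      perm : xs ↭ zeroPart ++ rest
      zero-sum : ∀ k → ∑ (λ x → v x k) zeroPart ≡ 0ℤ
      small-rest : length rest ℕ.≤ B

  -- Split off short zero-sum blocks in the first coordinate, then recurse on the blocks viewed as single vectors.
  zeroSumDecomposition : ∀ d M C {A : Set} (v : A → Fin d → ℤ) → (∀ x k → ∣ v x k ∣ ℕ.≤ M) →
                         ∀ xs → (∀ k → ∣ ∑ (λ x → v x k) xs ∣ ℕ.≤ C) →
                         ZeroSumDecomposition v (decompositionBound d M C) xs
  zeroSumDecomposition zero M C v _ xs _ = record
    { zeroPart = xs ; rest = [] ; perm = ↭-reflexive (sym (Listₚ.++-identityʳ xs)) ; zero-sum = λ () ; small-rest = z≤n }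
  zeroSumDecomposition (suc d) M C {A} v ∣v∣≤M xs ∣∑∣≤C = record
    { zeroPart = concatMap proj₁ Z.zeroPart ; rest = concatMap proj₁ Z.rest ++ rest ; perm = perm′
    ; zero-sum = zero-sum ; small-rest = small-rest′ }
    where
      head : A → ℤ
      head x = v x Fin.zero
      tail : A → Fin d → ℤ
      tail x k = v x (Fin.suc k)
      ∣tail∣≤M : ∀ k x → ∣ tail x k ∣ ℕ.≤ M
      ∣tail∣≤M k x = ∣v∣≤M x (Fin.suc k)
      open ShortZeroSumBlocks head M (λ x → ∣v∣≤M x Fin.zero) using (ShortZeroSumBlock; BlockDecomposition; decompose)
      open BlockDecomposition (decompose xs (∣∑∣≤C Fin.zero))
      blockSum : ShortZeroSumBlock → Fin d → ℤ
      blockSum b k = ∑ (λ x → tail x k) (proj₁ b)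
      ∣blockSum∣≤ : ∀ b k → ∣ blockSum b k ∣ ℕ.≤ blockWidth M ℕ.* M
      ∣blockSum∣≤ (b , _ , ≤W) k = ℕₚ.≤-trans (∣∑∣≤ (λ x → tail x k) M (∣tail∣≤M k) b) (ℕₚ.*-monoˡ-≤ M ≤W)
      ∑-blocks : ∀ k → ∑ (λ b → blockSum b k) blocks ≡ ∑ (λ x → tail x k) xs - ∑ (λ x → tail x k) rest
      ∑-blocks k = begin
        ∑ (λ b → blockSum b k) blocks                           ≡⟨ ∑-concatMap (λ x → tail x k) proj₁ blocks ⟨
        ∑ f (concatMap proj₁ blocks)                            ≡⟨ lemma _ (∑ f rest) ⟩
        ∑ f (concatMap proj₁ blocks) + ∑ f rest - ∑ f rest      ≡⟨ cong (_- ∑ f rest) (∑-++ f (concatMap proj₁ blocks) rest) ⟨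
        ∑ f (concatMap proj₁ blocks ++ rest) - ∑ f rest         ≡⟨ cong (_- ∑ f rest) (∑-↭ f perm) ⟨
        ∑ f xs - ∑ f rest                                       ∎
        where
          open ≡-Reasoning
          f = λ x → tail x k
          lemma : ∀ a b → a ≡ a + b - b
          lemma = solve-∀
      ∣∑-blocks∣≤ : ∀ k → ∣ ∑ (λ b → blockSum b k) blocks ∣ ℕ.≤ C ℕ.+ leftover M C ℕ.* M
      ∣∑-blocks∣≤ k = subst (λ s → ∣ s ∣ ℕ.≤ _) (sym (∑-blocks k))
        (ℕₚ.≤-trans (ℤₚ.∣i-j∣≤∣i∣+∣j∣ (∑ (λ x → tail x k) xs) (∑ (λ x → tail x k) rest))
          (ℕₚ.+-mono-≤ (∣∑∣≤C (Fin.suc k))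
            (ℕₚ.≤-trans (∣∑∣≤ (λ x → tail x k) M (∣tail∣≤M k) rest) (ℕₚ.*-monoˡ-≤ M small-rest))))
      module Z = ZeroSumDecomposition
        (zeroSumDecomposition d (blockWidth M ℕ.* M) (C ℕ.+ leftover M C ℕ.* M) blockSum ∣blockSum∣≤ blocks ∣∑-blocks∣≤)
      F′ = decompositionBound d (blockWidth M ℕ.* M) (C ℕ.+ leftover M C ℕ.* M)
      perm′ : xs ↭ concatMap proj₁ Z.zeroPart ++ concatMap proj₁ Z.rest ++ rest
      perm′ = begin
        xs                                                          ↭⟨ perm ⟩
        concatMap proj₁ blocks ++ rest                              ↭⟨ ++⁺ʳ rest (concat⁺ (map⁺ proj₁ Z.perm)) ⟩
        concatMap proj₁ (Z.zeroPart ++ Z.rest) ++ rest              ≡⟨ cong (_++ rest) (Listₚ.concatMap-++ proj₁ Z.zeroPart Z.rest) ⟩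
        (concatMap proj₁ Z.zeroPart ++ concatMap proj₁ Z.rest) ++ rest ≡⟨ Listₚ.++-assoc (concatMap proj₁ Z.zeroPart) _ rest ⟩
        concatMap proj₁ Z.zeroPart ++ concatMap proj₁ Z.rest ++ rest ∎
        where open PermutationReasoning
      zero-sum : ∀ k → ∑ (λ x → v x k) (concatMap proj₁ Z.zeroPart) ≡ 0ℤ
      zero-sum Fin.zero = trans (∑-concatMap head proj₁ Z.zeroPart)
                            (trans (∑-cong (λ b → proj₁ (proj₂ b)) Z.zeroPart) (∑-zero Z.zeroPart))
      zero-sum (Fin.suc k) = trans (∑-concatMap (λ x → tail x k) proj₁ Z.zeroPart) (Z.zero-sum k)
      small-rest′ : length (concatMap proj₁ Z.rest ++ rest) ℕ.≤ decompositionBound (suc d) M C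
      small-rest′ = begin
        length (concatMap proj₁ Z.rest ++ rest)          ≡⟨ Listₚ.length-++ (concatMap proj₁ Z.rest) ⟩
        length (concatMap proj₁ Z.rest) ℕ.+ length rest  ≤⟨ ℕₚ.+-mono-≤ (length-concatMap≤ proj₁ (λ b → proj₂ (proj₂ b)) Z.rest) small-rest ⟩
        length Z.rest ℕ.* blockWidth M ℕ.+ leftover M C  ≤⟨ ℕₚ.+-monoˡ-≤ (leftover M C) (ℕₚ.*-monoˡ-≤ (blockWidth M) Z.small-rest) ⟩
        F′ ℕ.* blockWidth M ℕ.+ leftover M C             ≡⟨ cong (ℕ._+ leftover M C) (ℕₚ.*-comm F′ (blockWidth M)) ⟩
        decompositionBound (suc d) M C                   ∎
        where open ℕₚ.≤-Reasoning

-- Size of the decomposition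
module _ where

  open import Data.Nat
  open import Data.Nat.Properties
  open import Data.Nat.Tactic.RingSolver using (solve-∀)
  open import Relation.Binary.PropositionalEquality

  -- For M ≤ X and C ≤ X², blockWidth M ≤ 3X and leftover M C ≤ 5X², so the recursive call of
  -- decompositionBound has parameters below 3X² and (3X²)².
  towerBound : ℕ → ℕ → ℕ
  towerBound zero X = 1
  towerBound (suc d) X = 9 * (X * X) * towerBound d (3 * (X * X))

  towerBound≥1 : ∀ d X → 1 ≤ X → 1 ≤ towerBound d X
  towerBound≥1 zero X _ = ≤-refl
  towerBound≥1 (suc d) (suc Y) _ =
    *-mono-≤ {1} {9 * (suc Y * suc Y)} (s≤s z≤n) (towerBound≥1 d (3 * (suc Y * suc Y)) (s≤s z≤n))

  n≤n*n : ∀ n → n ≤ n * n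
  n≤n*n zero = z≤n
  n≤n*n (suc n) = m≤m*n (suc n) (suc n)

  decompositionBound≤towerBound : ∀ d {X M C} → 1 ≤ X → M ≤ X → C ≤ X * X → decompositionBound d M C ≤ towerBound d X
  decompositionBound≤towerBound zero _ _ _ = z≤n
  decompositionBound≤towerBound (suc d) {X@(suc Y)} {M} {C} _ M≤X C≤X² = begin
    W * decompositionBound d (W * M) (C + L * M) + L   ≤⟨ +-mono-≤ (*-mono-≤ W≤3X IH) (≤-trans L≤5X² (≤-reflexive (sym (*-identityʳ _)))) ⟩
    3 * X * T + 5 * (X * X) * 1                         ≤⟨ +-mono-≤ (*-monoˡ-≤ T (*-monoʳ-≤ 3 (n≤n*n X))) (*-monoʳ-≤ (5 * (X * X)) T≥1) ⟩
    3 * (X * X) * T + 5 * (X * X) * T                   ≤⟨ ≤-reflexive (eight (X * X) T) ⟩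
    8 * (X * X) * T                                     ≤⟨ *-monoˡ-≤ T (*-monoˡ-≤ (X * X) (n≤1+n 8)) ⟩
    9 * (X * X) * T                                     ∎
    where
      open ≤-Reasoning
      W = blockWidth M
      L = leftover M C
      T = towerBound d (3 * (X * X))
      T≥1 : 1 ≤ T
      T≥1 = towerBound≥1 d (3 * (X * X)) (s≤s z≤n)
      eight : ∀ a b → 3 * a * b + 5 * a * b ≡ 8 * a * b
      eight = solve-∀
      W≤3X : W ≤ 3 * X
      W≤3X = ≤-trans (s≤s (*-monoʳ-≤ 2 M≤X)) (≤-trans (m≤m+n (suc (2 * X)) Y) (≤-reflexive (lemma Y)))
        where lemma : ∀ Y → suc (2 * suc Y) + Y ≡ 3 * suc Y
              lemma = solve-∀
      L≤5X² : L ≤ 5 * (X * X)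
      L≤5X² = begin
        2 * M + 2 * M * M + C          ≤⟨ +-mono-≤ (+-mono-≤ (*-monoʳ-≤ 2 M≤X) (*-mono-≤ (*-monoʳ-≤ 2 M≤X) M≤X)) C≤X² ⟩
        2 * X + 2 * X * X + X * X      ≤⟨ +-monoˡ-≤ (X * X) (+-monoˡ-≤ (2 * X * X) (*-monoʳ-≤ 2 (n≤n*n X))) ⟩
        2 * (X * X) + 2 * X * X + X * X ≡⟨ five X ⟩
        5 * (X * X)                    ∎
        where five : ∀ X → 2 * (X * X) + 2 * X * X + X * X ≡ 5 * (X * X)
              five = solve-∀
      WM≤3X² : W * M ≤ 3 * (X * X)
      WM≤3X² = ≤-trans (*-mono-≤ W≤3X M≤X) (≤-reflexive (*-assoc 3 X X))
      C′≤[3X²]² : C + L * M ≤ 3 * (X * X) * (3 * (X * X))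
      C′≤[3X²]² = begin
        C + L * M                                  ≤⟨ +-mono-≤ C≤X² (*-mono-≤ L≤5X² M≤X) ⟩
        X * X + 5 * (X * X) * X                    ≤⟨ +-monoʳ-≤ (X * X) (*-monoʳ-≤ (5 * (X * X)) (n≤n*n X)) ⟩
        X * X + 5 * (X * X) * (X * X)              ≤⟨ +-monoˡ-≤ (5 * (X * X) * (X * X)) (n≤n*n (X * X)) ⟩
        X * X * (X * X) + 5 * (X * X) * (X * X)    ≡⟨ six (X * X) ⟩
        6 * (X * X * (X * X))                      ≤⟨ *-monoˡ-≤ (X * X * (X * X)) (m≤m+n 6 3) ⟩
        9 * (X * X * (X * X))                      ≡⟨ nine (X * X) ⟩
        3 * (X * X) * (3 * (X * X))                ∎
        where six : ∀ z → z * z + 5 * z * z ≡ 6 * (z * z)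
              six = solve-∀
              nine : ∀ z → 9 * (z * z) ≡ 3 * z * (3 * z)
              nine = solve-∀
      IH : decompositionBound d (W * M) (C + L * M) ≤ T
      IH = decompositionBound≤towerBound d (s≤s z≤n) WM≤3X² C′≤[3X²]²

  towerBound*[3X]²≤ : ∀ d X → 1 ≤ X → towerBound d X * ((3 * X) * (3 * X)) ≤ (3 * X) ^ (2 ^ suc d)
  towerBound*[3X]²≤ zero X _ = ≤-reflexive (lemma X)
    where lemma : ∀ X → 1 * ((3 * X) * (3 * X)) ≡ (3 * X) * ((3 * X) * 1)
          lemma = solve-∀
  towerBound*[3X]²≤ (suc d) X 1≤X = begin
    9 * (X * X) * T * ((3 * X) * (3 * X))    ≡⟨ regroup X T ⟩
    T * ((3 * Y) * (3 * Y))                  ≤⟨ towerBound*[3X]²≤ d Y (*-mono-≤ {1} {3} (s≤s z≤n) (*-mono-≤ 1≤X 1≤X)) ⟩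
    (3 * Y) ^ (2 ^ suc d)                    ≡⟨ cong (_^ (2 ^ suc d)) (square X) ⟩
    ((3 * X) ^ 2) ^ (2 ^ suc d)              ≡⟨ ^-*-assoc (3 * X) 2 (2 ^ suc d) ⟩
    (3 * X) ^ (2 ^ suc (suc d))              ∎
    where
      open ≤-Reasoning
      Y = 3 * (X * X)
      T = towerBound d Y
      regroup : ∀ X T → 9 * (X * X) * T * ((3 * X) * (3 * X)) ≡ T * ((3 * (3 * (X * X))) * (3 * (3 * (X * X))))
      regroup = solve-∀
      square : ∀ X → 3 * (3 * (X * X)) ≡ (3 * X) * ((3 * X) * 1)
      square = solve-∀

  1≤2^ : ∀ n → 1 ≤ 2 ^ n
  1≤2^ n = m^n>0 2 n

  -- An optimal assignment has discrepancies of size at most K 4^K; the odd imbalances of the 2^K types add 2^K.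
  discrepancyBound : ℕ → ℕ
  discrepancyBound K = K * (2 ^ K * 2 ^ K) + 2 ^ K

  scale : ℕ → ℕ
  scale K = suc K * 2 ^ K

  1≤scale : ∀ K → 1 ≤ scale K
  1≤scale K = *-mono-≤ {1} {suc K} (s≤s z≤n) (1≤2^ K)

  4≤2^2^[1+K] : ∀ K → 4 ≤ 2 ^ (2 ^ suc K)
  4≤2^2^[1+K] K = ^-monoʳ-≤ 2 {2} (*-monoʳ-≤ 2 (1≤2^ K))

  3*scale≤2^2^[1+K] : ∀ K → 3 * scale K ≤ 2 ^ (2 ^ suc K)
  3*scale≤2^2^[1+K] zero = s≤s (s≤s (s≤s z≤n))
  3*scale≤2^2^[1+K] (suc K) = begin
    3 * (suc (suc K) * 2 ^ suc K)        ≤⟨ *-monoʳ-≤ 3 (*-monoˡ-≤ (2 ^ suc K) (2+K≤2[1+K] K)) ⟩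
    3 * (2 * suc K * 2 ^ suc K)          ≡⟨ regroup (suc K) (2 ^ K) ⟩
    4 * (3 * scale K)                    ≤⟨ *-mono-≤ (4≤2^2^[1+K] K) (3*scale≤2^2^[1+K] K) ⟩
    2 ^ (2 ^ suc K) * 2 ^ (2 ^ suc K)    ≡⟨ ^-distribˡ-+-* 2 (2 ^ suc K) (2 ^ suc K) ⟨
    2 ^ (2 ^ suc K + 2 ^ suc K)          ≡⟨ cong (λ e → 2 ^ (2 ^ suc K + e)) (+-identityʳ (2 ^ suc K)) ⟨
    2 ^ (2 ^ suc (suc K))                ∎
    where
      open ≤-Reasoning
      2+K≤2[1+K] : ∀ K → suc (suc K) ≤ 2 * suc K
      2+K≤2[1+K] K = ≤-trans (m≤m+n (suc (suc K)) K) (≤-reflexive (lemma K))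
        where lemma : ∀ K → suc (suc K) + K ≡ 2 * suc K
              lemma = solve-∀
      regroup : ∀ a b → 3 * (2 * a * (2 * b)) ≡ 4 * (3 * (a * b))
      regroup = solve-∀

  discrepancyBound≤scale² : ∀ K → discrepancyBound K ≤ scale K * scale K
  discrepancyBound≤scale² K = begin
    K * (P * P) + P                ≤⟨ +-monoʳ-≤ (K * (P * P)) (n≤n*n P) ⟩
    K * (P * P) + P * P            ≡⟨ lemma K P ⟩
    suc K * (P * P)                ≤⟨ *-monoˡ-≤ (P * P) (n≤n*n (suc K)) ⟩
    suc K * suc K * (P * P)        ≡⟨ lemma′ (suc K) P ⟩
    scale K * scale K              ∎
    where
      open ≤-Reasoning
      P = 2 ^ K
      lemma : ∀ K P → K * (P * P) + P * P ≡ suc K * (P * P)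
      lemma = solve-∀
      lemma′ : ∀ a P → a * a * (P * P) ≡ a * P * (a * P)
      lemma′ = solve-∀

  rebalancingBound≤boundMain : ∀ K → 2 ^ K * (2 * decompositionBound K 1 (discrepancyBound K) + 2) ≤ boundMain K
  rebalancingBound≤boundMain K = begin
    2 ^ K * (2 * F + 2)                              ≤⟨ *-monoʳ-≤ (2 ^ K) (+-mono-≤ (*-monoʳ-≤ 2 F≤T) (*-monoʳ-≤ 2 T≥1)) ⟩
    2 ^ K * (2 * T + 2 * T)                          ≡⟨ regroup (2 ^ K) T ⟩
    (2 ^ K * 4) * T                                  ≤⟨ *-mono-≤ 2^K*4≤ (≤-trans T≤[3X]^ [3X]^≤Base^) ⟩
    (2 ^ (a + K + 1) * KK) * (Base ^ (2 * 2 ^ K))    ≡⟨ reorder (2 ^ (a + K + 1)) KK (Base ^ (2 * 2 ^ K)) ⟩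
    boundMain K                                      ∎
    where
      open ≤-Reasoning
      X = scale K
      F = decompositionBound K 1 (discrepancyBound K)
      T = towerBound K X
      a = 2 ^ (K + 1)
      KK = K ! * K !
      Base = 2 ^ a * KK + 1
      a≡ : a ≡ 2 ^ suc K
      a≡ = cong (2 ^_) (+-comm K 1)
      F≤T : F ≤ T
      F≤T = decompositionBound≤towerBound K (1≤scale K) (1≤scale K) (discrepancyBound≤scale² K)
      T≥1 : 1 ≤ T
      T≥1 = towerBound≥1 K X (1≤scale K)
      1≤KK : 1 ≤ KK
      1≤KK = *-mono-≤ (1≤n! K) (1≤n! K)
      1≤3X : 1 ≤ 3 * X
      1≤3X = *-mono-≤ {1} {3} (s≤s z≤n) (1≤scale K)
      regroup : ∀ x y → x * (2 * y + 2 * y) ≡ x * 4 * y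
      regroup = solve-∀
      reorder : ∀ x y z → x * y * z ≡ z * x * y
      reorder = solve-∀
      T≤[3X]^ : T ≤ (3 * X) ^ (2 ^ suc K)
      T≤[3X]^ = ≤-trans (m≤m*n T ((3 * X) * (3 * X)) {{>-nonZero (*-mono-≤ 1≤3X 1≤3X)}}) (towerBound*[3X]²≤ K X (1≤scale K))
      [3X]^≤Base^ : (3 * X) ^ (2 ^ suc K) ≤ Base ^ (2 * 2 ^ K)
      [3X]^≤Base^ = ^-monoˡ-≤ (2 ^ suc K) (begin
        3 * X             ≤⟨ 3*scale≤2^2^[1+K] K ⟩
        2 ^ (2 ^ suc K)   ≡⟨ cong (2 ^_) a≡ ⟨
        2 ^ a             ≤⟨ m≤m*n (2 ^ a) KK {{>-nonZero 1≤KK}} ⟩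
        2 ^ a * KK        ≤⟨ m≤m+n (2 ^ a * KK) 1 ⟩
        Base              ∎)
      2^K*4≤ : 2 ^ K * 4 ≤ 2 ^ (a + K + 1) * KK
      2^K*4≤ = begin
        2 ^ K * 4                ≤⟨ *-monoʳ-≤ (2 ^ K) (subst (λ e → 4 ≤ 2 ^ e) (sym a≡) (4≤2^2^[1+K] K)) ⟩
        2 ^ K * 2 ^ a            ≤⟨ m≤m*n (2 ^ K * 2 ^ a) 2 ⟩
        2 ^ K * 2 ^ a * 2        ≡⟨ lemma (2 ^ K) (2 ^ a) ⟩
        2 ^ a * 2 ^ K * 2 ^ 1    ≡⟨ trans (^-distribˡ-+-* 2 (a + K) 1) (cong (_* 2 ^ 1) (^-distribˡ-+-* 2 a K)) ⟨
        2 ^ (a + K + 1)          ≤⟨ m≤m*n (2 ^ (a + K + 1)) KK {{>-nonZero 1≤KK}} ⟩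
        2 ^ (a + K + 1) * KK     ∎
        where lemma : ∀ x y → x * y * 2 ≡ y * x * (2 * 1)
              lemma = solve-∀

  withinBound : ∀ K {d} → d ≤ 2 ^ K * (2 * decompositionBound K 1 (discrepancyBound K) + 2) → WithinBound K d
  withinBound K d≤ rewrite m≤n⇒m∸n≡0 (≤-trans d≤ (rebalancingBound≤boundMain K)) = z≤n

-- Job types
module _ where

  open import Data.Nat as ℕ using (zero; suc)
  open import Data.Integer using (ℤ; +_; _+_; _*_; ∣_∣; 0ℤ; 1ℤ)
  import Data.Integer.Properties as ℤₚ
  open import Data.Bool using (Bool; true; false; not)
  import Data.Bool.Properties as Boolₚ
  open import Data.List using (List; []; _∷_; _++_; map; length; filter)
  import Data.List.Properties as Listₚ
  import Data.Nat.Properties as ℕₚ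
  open import Data.Empty using (⊥-elim)
  open import Data.Vec using (Vec; []; _∷_)
  import Data.Vec.Properties as Vecₚ
  open import Relation.Nullary using (Dec; yes; no; _×-dec_)
  open import Relation.Nullary.Decidable using (isYes)
  open import Relation.Binary using (DecidableEquality)
  open import Relation.Binary.PropositionalEquality

  bit : Bool → ℤ
  bit true = 1ℤ
  bit false = 0ℤ

  ∣bit∣≤1 : ∀ b → ∣ bit b ∣ ℕ.≤ 1
  ∣bit∣≤1 true = ℕ.s≤s ℕ.z≤n
  ∣bit∣≤1 false = ℕ.z≤n

  ∣bit*i∣≤∣i∣ : ∀ b i → ∣ bit b * i ∣ ℕ.≤ ∣ i ∣
  ∣bit*i∣≤∣i∣ true i = ℕₚ.≤-reflexive (cong ∣_∣ (ℤₚ.*-identityˡ i))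
  ∣bit*i∣≤∣i∣ false i = ℕ.z≤n

  𝟙 : {P : Set} → Dec P → ℤ
  𝟙 P? = bit (isYes P?)

  +length-filter : ∀ {A : Set} {P : A → Set} (P? : ∀ x → Dec (P x)) xs → + length (filter P? xs) ≡ ∑ (λ x → 𝟙 (P? x)) xs
  +length-filter P? [] = refl
  +length-filter P? (x ∷ xs) with P? x
  ... | yes _ = cong (λ s → 1ℤ + s) (+length-filter P? xs)
  ... | no _ = trans (+length-filter P? xs) (sym (ℤₚ.+-identityˡ _))

  𝟙-× : ∀ {P Q : Set} (P? : Dec P) (Q? : Dec Q) → 𝟙 (P? ×-dec Q?) ≡ 𝟙 P? * 𝟙 Q?
  𝟙-× (yes _) (yes _) = refl
  𝟙-× (yes _) (no _) = refl
  𝟙-× (no _) _ = refl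

  module Enumeration {T : Set} (_≟_ : DecidableEquality T) (everything : List T)
                     (once : ∀ t → ∑ (λ u → 𝟙 (t ≟ u)) everything ≡ 1ℤ) where

    𝟙-subst : ∀ (F : T → ℤ) t u → 𝟙 (t ≟ u) * F t ≡ 𝟙 (t ≟ u) * F u
    𝟙-subst F t u with t ≟ u
    ... | yes refl = refl
    ... | no _ = refl

    ∑-collapse : ∀ (F : T → ℤ) t → ∑ (λ u → 𝟙 (t ≟ u) * F u) everything ≡ F t
    ∑-collapse F t = begin
      ∑ (λ u → 𝟙 (t ≟ u) * F u) everything   ≡⟨ ∑-cong (λ u → trans (sym (𝟙-subst F t u)) (ℤₚ.*-comm _ (F t))) everything ⟩
      ∑ (λ u → F t * 𝟙 (t ≟ u)) everything   ≡⟨ ∑-*ˡ (F t) (λ u → 𝟙 (t ≟ u)) everything ⟩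
      F t * ∑ (λ u → 𝟙 (t ≟ u)) everything   ≡⟨ cong (F t *_) (once t) ⟩
      F t * 1ℤ                               ≡⟨ ℤₚ.*-identityʳ (F t) ⟩
      F t                                    ∎
      where open ≡-Reasoning

    𝟙-sym : ∀ t u → 𝟙 (t ≟ u) ≡ 𝟙 (u ≟ t)
    𝟙-sym t u with t ≟ u | u ≟ t
    ... | yes _ | yes _ = refl
    ... | no _ | no _ = refl
    ... | yes refl | no t≢t = ⊥-elim (t≢t refl)
    ... | no t≢t | yes refl = ⊥-elim (t≢t refl)

    ∑-collapse′ : ∀ (F : T → ℤ) t → ∑ (λ u → 𝟙 (u ≟ t) * F u) everything ≡ F t
    ∑-collapse′ F t = trans (∑-cong (λ u → cong (_* F u) (𝟙-sym u t)) everything) (∑-collapse F t)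

    ∑-byType : ∀ {A : Set} (τ : A → T) (g : A → ℤ) xs → ∑ g xs ≡ ∑ (λ t → ∑ (λ x → 𝟙 (τ x ≟ t) * g x) xs) everything
    ∑-byType τ g xs = trans (∑-cong (λ x → sym (∑-collapse (λ _ → g x) (τ x))) xs) (∑-comm (λ x t → 𝟙 (τ x ≟ t) * g x) xs everything)

  _≟ᵥ_ : ∀ {K} → DecidableEquality (Vec Bool K)
  _≟ᵥ_ = Vecₚ.≡-dec Boolₚ._≟_

  allVectors : ∀ K → List (Vec Bool K)
  allVectors zero = [] ∷ []
  allVectors (suc K) = map (true ∷_) (allVectors K) ++ map (false ∷_) (allVectors K)

  𝟙-∷-same : ∀ {K} b (t u : Vec Bool K) → 𝟙 ((b ∷ t) ≟ᵥ (b ∷ u)) ≡ 𝟙 (t ≟ᵥ u)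
  𝟙-∷-same true t u with t ≟ᵥ u
  ... | yes _ = refl
  ... | no _ = refl
  𝟙-∷-same false t u with t ≟ᵥ u
  ... | yes _ = refl
  ... | no _ = refl

  𝟙-∷-differ : ∀ {K} b (t u : Vec Bool K) → 𝟙 ((b ∷ t) ≟ᵥ (not b ∷ u)) ≡ 0ℤ
  𝟙-∷-differ true t u = refl
  𝟙-∷-differ false t u = refl

  allVectors-once : ∀ {K} (t : Vec Bool K) → ∑ (λ u → 𝟙 (t ≟ᵥ u)) (allVectors K) ≡ 1ℤ
  allVectors-once [] = refl
  allVectors-once {suc K} (b ∷ t) = begin
    ∑ (λ u → 𝟙 ((b ∷ t) ≟ᵥ u)) (map (true ∷_) (allVectors K) ++ map (false ∷_) (allVectors K))
      ≡⟨ ∑-++ _ (map (true ∷_) (allVectors K)) _ ⟩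
    ∑ (λ u → 𝟙 ((b ∷ t) ≟ᵥ u)) (map (true ∷_) (allVectors K)) + ∑ (λ u → 𝟙 ((b ∷ t) ≟ᵥ u)) (map (false ∷_) (allVectors K))
      ≡⟨ cong₂ _+_ (∑-map _ (true ∷_) (allVectors K)) (∑-map _ (false ∷_) (allVectors K)) ⟩
    ∑ (λ u → 𝟙 ((b ∷ t) ≟ᵥ (true ∷ u))) (allVectors K) + ∑ (λ u → 𝟙 ((b ∷ t) ≟ᵥ (false ∷ u))) (allVectors K)
      ≡⟨ halves b ⟩
    1ℤ ∎
    where
      open ≡-Reasoning
      vanishes : ∀ b → ∑ (λ u → 𝟙 ((b ∷ t) ≟ᵥ (not b ∷ u))) (allVectors K) ≡ 0ℤ
      vanishes b = trans (∑-cong (𝟙-∷-differ b t) (allVectors K)) (∑-zero (allVectors K))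
      recurse : ∀ b → ∑ (λ u → 𝟙 ((b ∷ t) ≟ᵥ (b ∷ u))) (allVectors K) ≡ 1ℤ
      recurse b = trans (∑-cong (𝟙-∷-same b t) (allVectors K)) (allVectors-once t)
      halves : ∀ b → ∑ (λ u → 𝟙 ((b ∷ t) ≟ᵥ (true ∷ u))) (allVectors K) + ∑ (λ u → 𝟙 ((b ∷ t) ≟ᵥ (false ∷ u))) (allVectors K) ≡ 1ℤ
      halves true = cong₂ _+_ (recurse true) (vanishes true)
      halves false = cong₂ _+_ (vanishes false) (recurse false)

  length-allVectors : ∀ K → length (allVectors K) ≡ 2 ℕ.^ K
  length-allVectors zero = refl
  length-allVectors (suc K) = begin
    length (map (true ∷_) (allVectors K) ++ map (false ∷_) (allVectors K))   ≡⟨ Listₚ.length-++ (map (true ∷_) (allVectors K)) ⟩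
    length (map (true ∷_) (allVectors K)) ℕ.+ length (map (false ∷_) (allVectors K))
      ≡⟨ cong₂ ℕ._+_ (Listₚ.length-map _ (allVectors K)) (Listₚ.length-map _ (allVectors K)) ⟩
    length (allVectors K) ℕ.+ length (allVectors K)                          ≡⟨ cong (λ l → l ℕ.+ l) (length-allVectors K) ⟩
    2 ℕ.^ K ℕ.+ 2 ℕ.^ K                                                      ≡⟨ cong (2 ℕ.^ K ℕ.+_) (ℕₚ.+-identityʳ _) ⟨
    2 ℕ.^ suc K                                                              ∎
    where open ≡-Reasoning

-- Walks and scheduling by type
module _ where

  open import Data.Nat as ℕ using (ℕ; zero; suc; z≤n; s≤s)
  import Data.Nat.Properties as ℕₚ
  open import Data.Integer using (ℤ; +_; -_; _+_; _-_; _*_; ∣_∣; 0ℤ; 1ℤ; -1ℤ)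
  import Data.Integer.Properties as ℤₚ
  open import Data.Integer.Tactic.RingSolver using (solve-∀)
  open import Data.Fin using (Fin; zero; suc; _≤?_)
  open import Data.List using (allFin)
  open import Data.Bool using (if_then_else_)
  open import Data.Product using (∃; _,_)
  open import Data.Sum using (_⊎_; inj₁; inj₂)
  open import Relation.Nullary using (yes; no)
  open import Relation.Nullary.Decidable using (isYes)
  open import Relation.Binary using (DecidableEquality)
  open import Relation.Binary.PropositionalEquality
  open import Data.Empty using (⊥-elim)
  open import Function using (_∘_)

  σ : Fin 2 → ℤ
  σ zero = 1ℤ
  σ (suc zero) = -1ℤ

  other : Fin 2 → Fin 2
  other zero = suc zero
  other (suc zero) = zero

  σ-other : ∀ i → σ (other i) ≡ - σ i
  σ-other zero = refl
  σ-other (suc zero) = refl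

  ∣σ∣≡1 : ∀ i → ∣ σ i ∣ ≡ 1
  ∣σ∣≡1 zero = refl
  ∣σ∣≡1 (suc zero) = refl

  ∣σ*i∣≡∣i∣ : ∀ s i → ∣ σ s * i ∣ ≡ ∣ i ∣
  ∣σ*i∣≡∣i∣ s i = trans (ℤₚ.∣i*j∣≡∣i∣*∣j∣ (σ s) i) (trans (cong (ℕ._* ∣ i ∣) (∣σ∣≡1 s)) (ℕₚ.*-identityˡ ∣ i ∣))

  walk : (ℕ → Fin 2) → ℕ → ℤ
  walk p zero = 0ℤ
  walk p (suc m) = σ (p 0) + walk (p ∘ suc) m

  walk-snoc : ∀ p m → walk p (suc m) ≡ walk p m + σ (p m)
  walk-snoc p zero = ℤₚ.+-comm (σ (p 0)) 0ℤ
  walk-snoc p (suc m) = trans (cong (λ s → σ (p 0) + s) (walk-snoc (p ∘ suc) m)) (sym (ℤₚ.+-assoc (σ (p 0)) _ _))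

  walk-other : ∀ p m → walk (other ∘ p) m ≡ - walk p m
  walk-other p zero = refl
  walk-other p (suc m) =
    trans (cong₂ _+_ (σ-other (p 0)) (walk-other (p ∘ suc) m)) (sym (ℤₚ.neg-distrib-+ (σ (p 0)) _))

  alternating : ℕ → Fin 2
  alternating zero = zero
  alternating (suc r) = other (alternating r)

  walk-alternating-suc : ∀ m → walk alternating (suc m) ≡ 1ℤ - walk alternating m
  walk-alternating-suc m = cong (λ s → 1ℤ + s) (walk-other alternating m)

  walk-alternating∈01 : ∀ m → walk alternating m ≡ 0ℤ ⊎ walk alternating m ≡ 1ℤ
  walk-alternating∈01 zero = inj₁ refl
  walk-alternating∈01 (suc m) with walk-alternating∈01 m
  ... | inj₁ w≡0 = inj₂ (trans (walk-alternating-suc m) (cong (λ s → 1ℤ - s) w≡0))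
  ... | inj₂ w≡1 = inj₁ (trans (walk-alternating-suc m) (cong (λ s → 1ℤ - s) w≡1))

  ∣walk-alternating∣≤1 : ∀ m → ∣ walk alternating m ∣ ℕ.≤ 1
  ∣walk-alternating∣≤1 m with walk-alternating∈01 m
  ... | inj₁ w≡0 = subst (λ w → ∣ w ∣ ℕ.≤ 1) (sym w≡0) z≤n
  ... | inj₂ w≡1 = subst (λ w → ∣ w ∣ ℕ.≤ 1) (sym w≡1) (s≤s z≤n)

  walk-alternating-even : ∀ q → walk alternating (2 ℕ.* q) ≡ 0ℤ
  walk-alternating-even zero = refl
  walk-alternating-even (suc q) = begin
    walk alternating (2 ℕ.* suc q)          ≡⟨ cong (walk alternating) (ℕₚ.*-suc 2 q) ⟩
    walk alternating (suc (suc (2 ℕ.* q)))  ≡⟨ walk-alternating-suc (suc (2 ℕ.* q)) ⟩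
    1ℤ - walk alternating (suc (2 ℕ.* q))   ≡⟨ cong (λ s → 1ℤ - s) (walk-alternating-suc (2 ℕ.* q)) ⟩
    1ℤ - (1ℤ - walk alternating (2 ℕ.* q))  ≡⟨ lemma (walk alternating (2 ℕ.* q)) ⟩
    walk alternating (2 ℕ.* q)              ≡⟨ walk-alternating-even q ⟩
    0ℤ                                      ∎
    where
      open ≡-Reasoning
      lemma : ∀ x → 1ℤ - (1ℤ - x) ≡ x
      lemma = solve-∀

  leading : Fin 2 → ℕ → ℕ → Fin 2
  leading i zero r = alternating r
  leading i (suc e) zero = i
  leading i (suc e) (suc r) = leading i e r

  walk-leading : ∀ i e q → walk (leading i e) (e ℕ.+ 2 ℕ.* q) ≡ + e * σ i
  walk-leading i zero q = walk-alternating-even q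
  walk-leading i (suc e) q = trans (cong (λ s → σ i + s) (walk-leading i e q)) (lemma (σ i) (+ e))
    where lemma : ∀ s e → s + e * s ≡ (1ℤ + e) * s
          lemma = solve-∀

  ∣walk-leading∣≤ : ∀ i e m → ∣ walk (leading i e) m ∣ ℕ.≤ suc e
  ∣walk-leading∣≤ i zero m = ∣walk-alternating∣≤1 m
  ∣walk-leading∣≤ i (suc e) zero = z≤n
  ∣walk-leading∣≤ i (suc e) (suc m) = ℕₚ.≤-trans (ℤₚ.∣i+j∣≤∣i∣+∣j∣ (σ i) (walk (leading i e) m))
    (subst (λ a → a ℕ.+ ∣ walk (leading i e) m ∣ ℕ.≤ suc (suc e)) (sym (∣σ∣≡1 i)) (s≤s (∣walk-leading∣≤ i e m)))

  𝟙-suc≤?suc : ∀ {n} (i j : Fin n) → 𝟙 (suc i ≤? suc j) ≡ 𝟙 (i ≤? j)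
  𝟙-suc≤?suc i j with suc i ≤? suc j | i ≤? j
  ... | yes _ | yes _ = refl
  ... | no _ | no _ = refl
  ... | yes (s≤s i≤j) | no i≰j = ⊥-elim (i≰j i≤j)
  ... | no 1+i≰1+j | yes i≤j = ⊥-elim (1+i≰1+j (s≤s i≤j))

  module JobScan {T : Set} (_≟_ : DecidableEquality T) where

    -- seen t is the number of jobs of type t scanned so far
    after : T → (T → ℕ) → T → ℕ
    after t₀ seen t = if isYes (t₀ ≟ t) then suc (seen t) else seen t

    occurrences : ∀ {n} → (Fin n → T) → T → ℕ
    occurrences {zero} τ t = 0
    occurrences {suc n} τ t = after (τ zero) (occurrences (τ ∘ suc)) t

    +occurrences : ∀ {n} (τ : Fin n → T) t → + occurrences τ t ≡ ∑ (λ j → 𝟙 (τ j ≟ t)) (allFin n)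
    +occurrences {zero} τ t = refl
    +occurrences {suc n} τ t = trans (+after (τ zero) t) (sym (∑-allFin-suc (λ j → 𝟙 (τ j ≟ t))))
      where
        +after : ∀ t₀ t → + after t₀ (occurrences (τ ∘ suc)) t ≡ 𝟙 (t₀ ≟ t) + ∑ (λ j → 𝟙 (τ (suc j) ≟ t)) (allFin n)
        +after t₀ t with t₀ ≟ t
        ... | yes _ = cong (λ s → 1ℤ + s) (+occurrences (τ ∘ suc) t)
        ... | no _ = trans (+occurrences (τ ∘ suc) t) (sym (ℤₚ.+-identityˡ _))

    -- Jobs are scanned in order; the r-th job of type t (from r = 0) goes to machine schedule t r.
    module _ (schedule : T → ℕ → Fin 2) where

      assign : ∀ {n} → (Fin n → T) → (T → ℕ) → Fin n → Fin 2
      assign τ seen zero = schedule (τ zero) (seen (τ zero))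
      assign τ seen (suc j) = assign (τ ∘ suc) (after (τ zero) seen) j

      W : T → ℕ → ℤ
      W t = walk (schedule t)

      walk-after : ∀ t₀ seen t → W t (after t₀ seen t) ≡ W t (seen t) + 𝟙 (t₀ ≟ t) * σ (schedule t₀ (seen t₀))
      walk-after t₀ seen t with t₀ ≟ t
      ... | yes refl = trans (walk-snoc (schedule t₀) (seen t₀)) (cong (λ s → W t₀ (seen t₀) + s) (sym (ℤₚ.*-identityˡ (σ (schedule t₀ (seen t₀))))))
      ... | no _ = sym (trans (cong (λ s → W t (seen t) + s) (ℤₚ.*-zeroˡ (σ (schedule t₀ (seen t₀))))) (ℤₚ.+-identityʳ (W t (seen t))))

      +-after : ∀ t₀ seen m t → seen t ℕ.+ after t₀ (λ _ → m) t ≡ after t₀ seen t ℕ.+ m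
      +-after t₀ seen m t with t₀ ≟ t
      ... | yes _ = ℕₚ.+-suc (seen t) m
      ... | no _ = refl

      prepend : ∀ t₀ seen t m →
        𝟙 (t₀ ≟ t) * σ (schedule t₀ (seen t₀)) + (W t (after t₀ seen t ℕ.+ m) - W t (after t₀ seen t))
          ≡ W t (seen t ℕ.+ after t₀ (λ _ → m) t) - W t (seen t)
      prepend t₀ seen t m = begin
        h + (W t (after t₀ seen t ℕ.+ m) - W t (after t₀ seen t))   ≡⟨ cong (λ w → h + (W t (after t₀ seen t ℕ.+ m) - w)) (walk-after t₀ seen t) ⟩
        h + (W t (after t₀ seen t ℕ.+ m) - (W t (seen t) + h))       ≡⟨ lemma h (W t (after t₀ seen t ℕ.+ m)) (W t (seen t)) ⟩
        W t (after t₀ seen t ℕ.+ m) - W t (seen t)                   ≡⟨ cong (λ k → W t k - W t (seen t)) (+-after t₀ seen m t) ⟨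
        W t (seen t ℕ.+ after t₀ (λ _ → m) t) - W t (seen t)         ∎
        where
          open ≡-Reasoning
          h = 𝟙 (t₀ ≟ t) * σ (schedule t₀ (seen t₀))
          lemma : ∀ h a b → h + (a - (b + h)) ≡ a - b
          lemma = solve-∀

      walk-empty : ∀ t s → 0ℤ ≡ W t (s ℕ.+ 0) - W t s
      walk-empty t s = sym (trans (cong (λ k → W t k - W t s) (ℕₚ.+-identityʳ s)) (ℤₚ.+-inverseʳ (W t s)))

      assign-total : ∀ {n} (τ : Fin n → T) seen t →
        ∑ (λ j → 𝟙 (τ j ≟ t) * σ (assign τ seen j)) (allFin n) ≡ W t (seen t ℕ.+ occurrences τ t) - W t (seen t)
      assign-total {zero} τ seen t = walk-empty t (seen t)
      assign-total {suc n} τ seen t = begin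
        ∑ f (allFin (suc n))                                                   ≡⟨ ∑-allFin-suc f ⟩
        f zero + ∑ (f ∘ suc) (allFin n)                                        ≡⟨ cong (λ s → f zero + s) (assign-total (τ ∘ suc) seen′ t) ⟩
        f zero + (W t (seen′ t ℕ.+ occurrences (τ ∘ suc) t) - W t (seen′ t))   ≡⟨ prepend (τ zero) seen t (occurrences (τ ∘ suc) t) ⟩
        W t (seen t ℕ.+ occurrences τ t) - W t (seen t)                        ∎
        where
          open ≡-Reasoning
          f = λ j → 𝟙 (τ j ≟ t) * σ (assign τ seen j)
          seen′ = after (τ zero) seen

      assign-prefix : ∀ {n} (τ : Fin n → T) seen t (j : Fin n) → ∃ λ m →
        ∑ (λ j′ → 𝟙 (τ j′ ≟ t) * (𝟙 (j′ ≤? j) * σ (assign τ seen j′))) (allFin n) ≡ W t (seen t ℕ.+ m) - W t (seen t)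
      assign-prefix {suc n} τ seen t j = runs j
        where
          f : Fin (suc n) → Fin (suc n) → ℤ
          f j j′ = 𝟙 (τ j′ ≟ t) * (𝟙 (j′ ≤? j) * σ (assign τ seen j′))
          seen′ = after (τ zero) seen
          first : ∀ j → f j zero ≡ 𝟙 (τ zero ≟ t) * σ (schedule (τ zero) (seen (τ zero)))
          first j = cong (𝟙 (τ zero ≟ t) *_) (ℤₚ.*-identityˡ _)
          runs : ∀ j → ∃ λ m → ∑ (f j) (allFin (suc n)) ≡ W t (seen t ℕ.+ m) - W t (seen t)
          runs zero = _ , trans (∑-allFin-suc (f zero)) (trans (cong₂ _+_ (first zero) later) (prepend (τ zero) seen t 0))
            where
              later : ∑ (f zero ∘ suc) (allFin n) ≡ W t (seen′ t ℕ.+ 0) - W t (seen′ t)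
              later = trans (∑-cong (λ j′ → ℤₚ.*-zeroʳ (𝟙 (τ (suc j′) ≟ t))) (allFin n)) (trans (∑-zero (allFin n)) (walk-empty t (seen′ t)))
          runs (suc j) with m , run ← assign-prefix (τ ∘ suc) seen′ t j =
            _ , trans (∑-allFin-suc (f (suc j))) (trans (cong₂ _+_ (first (suc j)) (trans (∑-cong shift (allFin n)) run))
                                                       (prepend (τ zero) seen t m))
            where
              shift : ∀ j′ → f (suc j) (suc j′) ≡ 𝟙 (τ (suc j′) ≟ t) * (𝟙 (j′ ≤? j) * σ (assign (τ ∘ suc) seen′ j′))
              shift j′ = cong (λ b → 𝟙 (τ (suc j′) ≟ t) * (b * σ (assign (τ ∘ suc) seen′ j′))) (𝟙-suc≤?suc j′ j)

-- The cost through the discrepancies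
module _ where

  open import Data.Nat as ℕ using (ℕ; zero; suc)
  import Data.Nat.Properties as ℕₚ
  open import Data.Nat.DivMod using (_/_; m*n/n≡m)
  import Data.Nat.Tactic.RingSolver as ℕ-Solver
  open import Data.Integer using (ℤ; +_; -_; _+_; _-_; _*_; 1ℤ; _≤_)
  import Data.Integer as ℤ
  import Data.Integer.Properties as ℤₚ
  open import Data.Integer.Tactic.RingSolver using (solve-∀)
  open import Data.Bool using (true; false; _∧_)
  open import Data.Fin using (Fin; zero; suc; _≤?_)
  open import Data.Fin.Properties using (_≟_)
  open import Data.Fin.Subset using (Subset; _∩_; ∣_∣)
  open import Data.Vec using ([]; _∷_; lookup)
  import Data.Vec.Properties as Vecₚ
  open import Data.List using ([]; _∷_; allFin; map; foldr)
  open import Data.Sum using (inj₁; inj₂)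
  open import Relation.Nullary.Decidable using (isYes)
  open import Relation.Binary.PropositionalEquality
  open import Function using (_∘_)

  bit-∧ : ∀ a b → bit (a ∧ b) ≡ bit a * bit b
  bit-∧ true b = sym (ℤₚ.*-identityˡ (bit b))
  bit-∧ false b = refl

  card-∑ : ∀ {n} (v : Subset n) → + ∣ v ∣ ≡ ∑ (bit ∘ lookup v) (allFin n)
  card-∑ [] = refl
  card-∑ (true ∷ v) = trans (cong (λ s → 1ℤ + s) (card-∑ v)) (sym (∑-allFin-suc (bit ∘ lookup (true ∷ v))))
  card-∑ (false ∷ v) = trans (card-∑ v) (sym (trans (∑-allFin-suc (bit ∘ lookup (false ∷ v))) (ℤₚ.+-identityˡ _)))

  +∑≡∑+ : ∀ {A : Set} (g : A → ℕ) xs → + foldr ℕ._+_ 0 (map g xs) ≡ ∑ (λ x → + g x) xs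
  +∑≡∑+ g [] = refl
  +∑≡∑+ g (x ∷ xs) = trans (ℤₚ.pos-+ (g x) _) (cong (λ s → + g x + s) (+∑≡∑+ g xs))

  triangular : ℕ → ℕ
  triangular zero = 0
  triangular (suc c) = suc c ℕ.+ triangular c

  pronic≡triangular*2 : ∀ c → c ℕ.* (c ℕ.+ 1) ≡ triangular c ℕ.* 2
  pronic≡triangular*2 zero = refl
  pronic≡triangular*2 (suc c) = trans (lemma c) (trans (cong (λ t → t ℕ.+ 2 ℕ.* suc c) (pronic≡triangular*2 c)) (lemma′ (triangular c) c))
    where
      lemma : ∀ c → suc c ℕ.* (suc c ℕ.+ 1) ≡ c ℕ.* (c ℕ.+ 1) ℕ.+ 2 ℕ.* suc c
      lemma = ℕ-Solver.solve-∀
      lemma′ : ∀ t c → t ℕ.* 2 ℕ.+ 2 ℕ.* suc c ≡ (suc c ℕ.+ t) ℕ.* 2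
      lemma′ = ℕ-Solver.solve-∀

  -- c(c+1)/2 is the cost of c unit jobs on one machine.
  2*cost : ∀ c → + (2 ℕ.* (c ℕ.* (c ℕ.+ 1) / 2)) ≡ + c * (+ c + 1ℤ)
  2*cost c = begin
    + (2 ℕ.* (c ℕ.* (c ℕ.+ 1) / 2))   ≡⟨ cong (λ t → + (2 ℕ.* t)) (trans (cong (_/ 2) (pronic≡triangular*2 c)) (m*n/n≡m (triangular c) 2)) ⟩
    + (2 ℕ.* triangular c)             ≡⟨ cong +_ (trans (ℕₚ.*-comm 2 (triangular c)) (sym (pronic≡triangular*2 c))) ⟩
    + (c ℕ.* (c ℕ.+ 1))                ≡⟨ ℤₚ.pos-* c (c ℕ.+ 1) ⟩
    + c * + (c ℕ.+ 1)                  ≡⟨ cong (+ c *_) (ℤₚ.pos-+ c 1) ⟩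
    + c * (+ c + 1ℤ)                   ∎
    where open ≡-Reasoning

  𝟙-machine-sum : ∀ (i : Fin 2) → 𝟙 (i ≟ zero) + 𝟙 (i ≟ suc zero) ≡ 1ℤ
  𝟙-machine-sum zero = refl
  𝟙-machine-sum (suc zero) = refl

  𝟙-machine-difference : ∀ (i : Fin 2) → 𝟙 (i ≟ zero) - 𝟙 (i ≟ suc zero) ≡ σ i
  𝟙-machine-difference zero = refl
  𝟙-machine-difference (suc zero) = refl

  module _ {n : ℕ} (φ : Assignment n) where

    lookup-machineJobs : ∀ i j → lookup (machineJobs φ i) j ≡ isYes (φ j ≟ i)
    lookup-machineJobs i j = Vecₚ.lookup∘tabulate (λ j → isYes (φ j ≟ i)) j

    module Loads (v : Fin 2 → Subset n) (w : Fin n → ℤ) (v≡ : ∀ i j → bit (lookup (v i) j) ≡ 𝟙 (φ j ≟ i) * w j) where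

      load-sum : + ∣ v zero ∣ + + ∣ v (suc zero) ∣ ≡ ∑ w (allFin n)
      load-sum = begin
        + ∣ v zero ∣ + + ∣ v (suc zero) ∣
          ≡⟨ cong₂ _+_ (trans (card-∑ (v zero)) (∑-cong (v≡ zero) (allFin n))) (trans (card-∑ (v (suc zero))) (∑-cong (v≡ (suc zero)) (allFin n))) ⟩
        ∑ (λ j → 𝟙 (φ j ≟ zero) * w j) (allFin n) + ∑ (λ j → 𝟙 (φ j ≟ suc zero) * w j) (allFin n)
          ≡⟨ ∑-+ _ _ (allFin n) ⟨
        ∑ (λ j → 𝟙 (φ j ≟ zero) * w j + 𝟙 (φ j ≟ suc zero) * w j) (allFin n)
          ≡⟨ ∑-cong both (allFin n) ⟩
        ∑ w (allFin n) ∎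
        where
          open ≡-Reasoning
          both : ∀ j → 𝟙 (φ j ≟ zero) * w j + 𝟙 (φ j ≟ suc zero) * w j ≡ w j
          both j = trans (sym (ℤₚ.*-distribʳ-+ (w j) (𝟙 (φ j ≟ zero)) (𝟙 (φ j ≟ suc zero))))
                         (trans (cong (_* w j) (𝟙-machine-sum (φ j))) (ℤₚ.*-identityˡ (w j)))

      load-difference : + ∣ v zero ∣ - + ∣ v (suc zero) ∣ ≡ ∑ (λ j → w j * σ (φ j)) (allFin n)
      load-difference = begin
        + ∣ v zero ∣ - + ∣ v (suc zero) ∣
          ≡⟨ cong₂ _-_ (trans (card-∑ (v zero)) (∑-cong (v≡ zero) (allFin n))) (trans (card-∑ (v (suc zero))) (∑-cong (v≡ (suc zero)) (allFin n))) ⟩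
        ∑ (λ j → 𝟙 (φ j ≟ zero) * w j) (allFin n) - ∑ (λ j → 𝟙 (φ j ≟ suc zero) * w j) (allFin n)
          ≡⟨ ∑-difference _ _ (allFin n) ⟨
        ∑ (λ j → 𝟙 (φ j ≟ zero) * w j - 𝟙 (φ j ≟ suc zero) * w j) (allFin n)
          ≡⟨ ∑-cong (λ j → trans (lemma (𝟙 (φ j ≟ zero)) (𝟙 (φ j ≟ suc zero)) (w j)) (cong (w j *_) (𝟙-machine-difference (φ j)))) (allFin n) ⟩
        ∑ (λ j → w j * σ (φ j)) (allFin n) ∎
        where
          open ≡-Reasoning
          lemma : ∀ a b w → a * w - b * w ≡ w * (a - b)
          lemma = solve-∀

  m⊔n∸m⊓n≡∣m-n∣ : ∀ m n → (m ℕ.⊔ n) ℕ.∸ (m ℕ.⊓ n) ≡ ℤ.∣ + m - + n ∣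
  m⊔n∸m⊓n≡∣m-n∣ m n with ℕₚ.≤-total m n
  ... | inj₁ m≤n = trans (cong₂ ℕ._∸_ (ℕₚ.m≤n⇒m⊔n≡n m≤n) (ℕₚ.m≤n⇒m⊓n≡m m≤n))
                         (trans (cong ℤ.∣_∣ (+[m∸n]≡+m-+n m≤n)) (ℤₚ.∣i-j∣≡∣j-i∣ (+ n) (+ m)))
  ... | inj₂ n≤m = trans (cong₂ ℕ._∸_ (ℕₚ.m≥n⇒m⊔n≡m n≤m) (ℕₚ.m≥n⇒m⊓n≡n n≤m)) (cong ℤ.∣_∣ (+[m∸n]≡+m-+n n≤m))

  maxFin≤ : ∀ k (f : Fin k → ℕ) {B} → (∀ x → f x ℕ.≤ B) → maxFin k f ℕ.≤ B
  maxFin≤ k f {B} f≤B = go (allFin k)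
    where
      go : ∀ xs → foldr ℕ._⊔_ 0 (map f xs) ℕ.≤ B
      go [] = ℕ.z≤n
      go (x ∷ xs) = ℕₚ.⊔-lub (f≤B x) (go xs)

  module _ {n K : ℕ} (S : Scenarios n K) where

    inScenario : Fin K → Fin n → ℤ
    inScenario k j = bit (lookup (S k) j)

    scenarioSize : Fin K → ℤ
    scenarioSize k = ∑ (inScenario k) (allFin n)

    discrepancy : Assignment n → Fin K → ℤ
    discrepancy φ k = ∑ (λ j → inScenario k j * σ (φ j)) (allFin n)

    prefixDiscrepancy : Assignment n → Fin n → Fin K → ℤ
    prefixDiscrepancy φ j₀ k = ∑ (λ j → inScenario k j * (𝟙 (j ≤? j₀) * σ (φ j))) (allFin n)

    module ScenarioLoads (φ : Assignment n) (k : Fin K) = Loads φ (λ i → machineJobs φ i ∩ S k) (inScenario k)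
      (λ i j → trans (cong bit (trans (Vecₚ.lookup-zipWith _∧_ j (machineJobs φ i) (S k))
                                      (cong (_∧ lookup (S k) j) (lookup-machineJobs φ i j))))
                     (bit-∧ (isYes (φ j ≟ i)) (lookup (S k) j)))

    prefixLoad-difference : ∀ φ j₀ k → + prefixLoad S φ j₀ k zero - + prefixLoad S φ j₀ k (suc zero) ≡ prefixDiscrepancy φ j₀ k
    prefixLoad-difference φ j₀ k =
      trans (Loads.load-difference φ (λ i → (machineJobs φ i ∩ S k) ∩ prefix j₀) (λ j → inScenario k j * 𝟙 (j ≤? j₀)) v≡)
            (∑-cong (λ j → ℤₚ.*-assoc (inScenario k j) (𝟙 (j ≤? j₀)) (σ (φ j))) (allFin n))
      where
        v≡ : ∀ i j → bit (lookup ((machineJobs φ i ∩ S k) ∩ prefix j₀) j) ≡ 𝟙 (φ j ≟ i) * (inScenario k j * 𝟙 (j ≤? j₀))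
        v≡ i j = begin
          bit (lookup ((machineJobs φ i ∩ S k) ∩ prefix j₀) j)
            ≡⟨ cong bit (Vecₚ.lookup-zipWith _∧_ j (machineJobs φ i ∩ S k) (prefix j₀)) ⟩
          bit (lookup (machineJobs φ i ∩ S k) j ∧ lookup (prefix j₀) j)
            ≡⟨ cong₂ (λ a b → bit (a ∧ b)) (trans (Vecₚ.lookup-zipWith _∧_ j (machineJobs φ i) (S k))
                                                   (cong (_∧ lookup (S k) j) (lookup-machineJobs φ i j)))
                                            (Vecₚ.lookup∘tabulate (λ j → isYes (j ≤? j₀)) j) ⟩
          bit ((isYes (φ j ≟ i) ∧ lookup (S k) j) ∧ isYes (j ≤? j₀))
            ≡⟨ bit-∧ (isYes (φ j ≟ i) ∧ lookup (S k) j) (isYes (j ≤? j₀)) ⟩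
          bit (isYes (φ j ≟ i) ∧ lookup (S k) j) * 𝟙 (j ≤? j₀)
            ≡⟨ cong (_* 𝟙 (j ≤? j₀)) (bit-∧ (isYes (φ j ≟ i)) (lookup (S k) j)) ⟩
          𝟙 (φ j ≟ i) * inScenario k j * 𝟙 (j ≤? j₀)
            ≡⟨ ℤₚ.*-assoc (𝟙 (φ j ≟ i)) (inScenario k j) (𝟙 (j ≤? j₀)) ⟩
          𝟙 (φ j ≟ i) * (inScenario k j * 𝟙 (j ≤? j₀)) ∎
          where open ≡-Reasoning

    4*G : ∀ φ k → + (4 ℕ.* G S φ k) ≡ scenarioSize k * scenarioSize k + + 2 * scenarioSize k + discrepancy φ k * discrepancy φ k
    4*G φ k = begin
      + (4 ℕ.* (A ℕ.+ (B ℕ.+ 0)))               ≡⟨ cong +_ (lemma A B) ⟩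
      + (2 ℕ.* (2 ℕ.* A) ℕ.+ 2 ℕ.* (2 ℕ.* B))   ≡⟨ ℤₚ.pos-+ (2 ℕ.* (2 ℕ.* A)) (2 ℕ.* (2 ℕ.* B)) ⟩
      + (2 ℕ.* (2 ℕ.* A)) + + (2 ℕ.* (2 ℕ.* B)) ≡⟨ cong₂ _+_ (ℤₚ.pos-* 2 (2 ℕ.* A)) (ℤₚ.pos-* 2 (2 ℕ.* B)) ⟩
      + 2 * + (2 ℕ.* A) + + 2 * + (2 ℕ.* B)     ≡⟨ cong₂ (λ x y → + 2 * x + + 2 * y) (2*cost a) (2*cost b) ⟩
      + 2 * (+ a * (+ a + 1ℤ)) + + 2 * (+ b * (+ b + 1ℤ))
        ≡⟨ lemma′ (+ a) (+ b) ⟩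
      (+ a + + b) * (+ a + + b) + + 2 * (+ a + + b) + (+ a - + b) * (+ a - + b)
        ≡⟨ cong₂ (λ s d → s * s + + 2 * s + d * d) load-sum load-difference ⟩
      scenarioSize k * scenarioSize k + + 2 * scenarioSize k + discrepancy φ k * discrepancy φ k ∎
      where
        open ≡-Reasoning
        open ScenarioLoads φ k
        a = ∣ machineJobs φ zero ∩ S k ∣
        b = ∣ machineJobs φ (suc zero) ∩ S k ∣
        A = a ℕ.* (a ℕ.+ 1) / 2
        B = b ℕ.* (b ℕ.+ 1) / 2
        lemma : ∀ A B → 4 ℕ.* (A ℕ.+ (B ℕ.+ 0)) ≡ 2 ℕ.* (2 ℕ.* A) ℕ.+ 2 ℕ.* (2 ℕ.* B)
        lemma = ℕ-Solver.solve-∀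
        lemma′ : ∀ a b → + 2 * (a * (a + 1ℤ)) + + 2 * (b * (b + 1ℤ)) ≡ (a + b) * (a + b) + + 2 * (a + b) + (a - b) * (a - b)
        lemma′ = solve-∀

    ∑discrepancy² : Assignment n → ℤ
    ∑discrepancy² φ = ∑ (λ k → discrepancy φ k * discrepancy φ k) (allFin K)

    sizeTerm : ℤ
    sizeTerm = ∑ (λ k → scenarioSize k * scenarioSize k + + 2 * scenarioSize k) (allFin K)

    4*totalCost : ∀ φ → + (4 ℕ.* totalCost S φ) ≡ sizeTerm + ∑discrepancy² φ
    4*totalCost φ = begin
      + (4 ℕ.* totalCost S φ)                        ≡⟨ ℤₚ.pos-* 4 (totalCost S φ) ⟩
      + 4 * + totalCost S φ                          ≡⟨ cong (+ 4 *_) (+∑≡∑+ (G S φ) (allFin K)) ⟩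
      + 4 * ∑ (λ k → + G S φ k) (allFin K)           ≡⟨ ∑-*ˡ (+ 4) (λ k → + G S φ k) (allFin K) ⟨
      ∑ (λ k → + 4 * + G S φ k) (allFin K)           ≡⟨ ∑-cong (λ k → trans (sym (ℤₚ.pos-* 4 (G S φ k))) (4*G φ k)) (allFin K) ⟩
      ∑ (λ k → scenarioSize k * scenarioSize k + + 2 * scenarioSize k + discrepancy φ k * discrepancy φ k) (allFin K)
                                                     ≡⟨ ∑-+ (λ k → scenarioSize k * scenarioSize k + + 2 * scenarioSize k)
                                                            (λ k → discrepancy φ k * discrepancy φ k) (allFin K) ⟩
      sizeTerm + ∑discrepancy² φ                     ∎
      where open ≡-Reasoning

    totalCost-cong : ∀ φ ψ → (∀ k → discrepancy ψ k ≡ discrepancy φ k) → totalCost S ψ ≡ totalCost S φ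
    totalCost-cong φ ψ same = ℕₚ.*-cancelˡ-≡ (totalCost S ψ) (totalCost S φ) 4 (ℤₚ.+-injective
      (trans (4*totalCost ψ) (trans (cong (λ s → sizeTerm + s) (∑-cong (λ k → cong₂ _*_ (same k) (same k)) (allFin K))) (sym (4*totalCost φ)))))

    ∑discrepancy²-mono : ∀ φ ψ → totalCost S φ ℕ.≤ totalCost S ψ → ∑discrepancy² φ ≤ ∑discrepancy² ψ
    ∑discrepancy²-mono φ ψ φ≤ψ = +-cancelˡ-≤ sizeTerm (subst₂ _≤_ (4*totalCost φ) (4*totalCost ψ) (ℤ.+≤+ (ℕₚ.*-monoʳ-≤ 4 φ≤ψ)))

    fullDisbalance≤ : ∀ φ {B} → (∀ j k → ℤ.∣ prefixDiscrepancy φ j k ∣ ℕ.≤ B) → fullDisbalance S φ ℕ.≤ B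
    fullDisbalance≤ φ bound = maxFin≤ n _ λ j → maxFin≤ K _ λ k →
      subst (ℕ._≤ _) (sym (loads≡ j k)) (bound j k)
      where
        loads≡ : ∀ j k → (prefixLoad S φ j k zero ℕ.⊔ prefixLoad S φ j k (suc zero)) ℕ.∸ (prefixLoad S φ j k zero ℕ.⊓ prefixLoad S φ j k (suc zero))
                         ≡ ℤ.∣ prefixDiscrepancy φ j k ∣
        loads≡ j k = trans (m⊔n∸m⊓n≡∣m-n∣ (prefixLoad S φ j k zero) (prefixLoad S φ j k (suc zero)))
                           (cong ℤ.∣_∣ (prefixLoad-difference φ j k))

-- Rebalancing an optimal assignment
module _ where

  open import Data.Nat as ℕ using (ℕ; zero; suc; z≤n; s≤s)
  import Data.Nat.Properties as ℕₚ
  open import Data.Integer using (ℤ; +_; -_; _+_; _-_; _*_; ∣_∣; 0ℤ; 1ℤ; -1ℤ; _≤_)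
  import Data.Integer as ℤ
  import Data.Integer.Properties as ℤₚ
  open import Data.Integer.Tactic.RingSolver using (solve-∀)
  open import Data.Bool using (Bool; if_then_else_)
  open import Relation.Nullary using (yes; no; _×-dec_)
  open import Relation.Nullary.Decidable using (isYes)
  import Data.Nat.Tactic.RingSolver as ℕ-Solver
  open import Data.Nat.DivMod using (_/_; _%_; m≡m%n+[m/n]*n; m%n<n)
  open import Data.Fin using (Fin; zero; suc; _≤?_)
  open import Data.Fin.Properties using (_≟_)
  open import Data.Vec using (Vec; lookup; tabulate)
  import Data.Vec.Properties as Vecₚ
  open import Data.List using (List; _++_; allFin; length; filter; concatMap; replicate)
  import Data.List.Properties as Listₚ
  open import Data.List.Membership.Propositional.Properties using (∈-allFin)
  open import Data.Product using (∃; _,_)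
  open import Data.Sum using (inj₁; inj₂)
  open import Relation.Binary.PropositionalEquality
  open import Function using (_∘_)

  heavier : ℕ → ℕ → Fin 2
  heavier x y = if isYes (y ℕ.≤? x) then zero else suc zero

  difference-heavier : ∀ x y → + x - + y ≡ + ℕ.∣ x - y ∣ * σ (heavier x y)
  difference-heavier x y with y ℕ.≤? x
  ... | yes y≤x = trans (sym (+[m∸n]≡+m-+n y≤x))
                        (trans (cong +_ (sym (ℕₚ.m≤n⇒∣n-m∣≡n∸m y≤x))) (sym (ℤₚ.*-identityʳ _)))
  ... | no y≰x = begin
    + x - + y                 ≡⟨ lemma (+ x) (+ y) ⟩
    (+ y - + x) * -1ℤ         ≡⟨ cong (_* -1ℤ) (+[m∸n]≡+m-+n x≤y) ⟨
    + (y ℕ.∸ x) * -1ℤ         ≡⟨ cong (λ d → + d * -1ℤ) (ℕₚ.m≤n⇒∣m-n∣≡n∸m x≤y) ⟨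
    + ℕ.∣ x - y ∣ * -1ℤ       ∎
    where
      open ≡-Reasoning
      x≤y = ℕₚ.<⇒≤ (ℕₚ.≰⇒> y≰x)
      lemma : ∀ a b → a - b ≡ (b - a) * -1ℤ
      lemma = solve-∀

  ∣m-n∣+2[m⊓n]≡m+n : ∀ m n → ℕ.∣ m - n ∣ ℕ.+ 2 ℕ.* (m ℕ.⊓ n) ≡ m ℕ.+ n
  ∣m-n∣+2[m⊓n]≡m+n m n with ℕₚ.≤-total m n
  ... | inj₁ m≤n = begin
    ℕ.∣ m - n ∣ ℕ.+ 2 ℕ.* (m ℕ.⊓ n)   ≡⟨ cong₂ (λ d l → d ℕ.+ 2 ℕ.* l) (ℕₚ.m≤n⇒∣m-n∣≡n∸m m≤n) (ℕₚ.m≤n⇒m⊓n≡m m≤n) ⟩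
    (n ℕ.∸ m) ℕ.+ 2 ℕ.* m             ≡⟨ lemma (n ℕ.∸ m) m ⟩
    ((n ℕ.∸ m) ℕ.+ m) ℕ.+ m           ≡⟨ cong (ℕ._+ m) (ℕₚ.m∸n+n≡m m≤n) ⟩
    n ℕ.+ m                           ≡⟨ ℕₚ.+-comm n m ⟩
    m ℕ.+ n                           ∎
    where
      open ≡-Reasoning
      lemma : ∀ d m → d ℕ.+ 2 ℕ.* m ≡ d ℕ.+ m ℕ.+ m
      lemma = ℕ-Solver.solve-∀
  ... | inj₂ n≤m = begin
    ℕ.∣ m - n ∣ ℕ.+ 2 ℕ.* (m ℕ.⊓ n)   ≡⟨ cong₂ (λ d l → d ℕ.+ 2 ℕ.* l) (ℕₚ.m≤n⇒∣n-m∣≡n∸m n≤m) (ℕₚ.m≥n⇒m⊓n≡n n≤m) ⟩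
    (m ℕ.∸ n) ℕ.+ 2 ℕ.* n             ≡⟨ lemma (m ℕ.∸ n) n ⟩
    ((m ℕ.∸ n) ℕ.+ n) ℕ.+ n           ≡⟨ cong (ℕ._+ n) (ℕₚ.m∸n+n≡m n≤m) ⟩
    m ℕ.+ n                           ∎
    where
      open ≡-Reasoning
      lemma : ∀ d m → d ℕ.+ 2 ℕ.* m ≡ d ℕ.+ m ℕ.+ m
      lemma = ℕ-Solver.solve-∀

  -- Moving f jobs from the heavier machine to the lighter one, within one type.
  moved-split : ∀ x y f → 2 ℕ.* f ℕ.≤ ℕ.∣ x - y ∣ →
                x ℕ.+ y ≡ (ℕ.∣ x - y ∣ ℕ.∸ 2 ℕ.* f) ℕ.+ 2 ℕ.* (x ℕ.⊓ y ℕ.+ f)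
  moved-split x y f 2f≤ = begin
    x ℕ.+ y                                             ≡⟨ ∣m-n∣+2[m⊓n]≡m+n x y ⟨
    ℕ.∣ x - y ∣ ℕ.+ 2 ℕ.* (x ℕ.⊓ y)                     ≡⟨ cong (λ d → d ℕ.+ 2 ℕ.* (x ℕ.⊓ y)) (ℕₚ.m∸n+n≡m 2f≤) ⟨
    (ℕ.∣ x - y ∣ ℕ.∸ 2 ℕ.* f) ℕ.+ 2 ℕ.* f ℕ.+ 2 ℕ.* (x ℕ.⊓ y) ≡⟨ lemma (ℕ.∣ x - y ∣ ℕ.∸ 2 ℕ.* f) f (x ℕ.⊓ y) ⟩
    (ℕ.∣ x - y ∣ ℕ.∸ 2 ℕ.* f) ℕ.+ 2 ℕ.* (x ℕ.⊓ y ℕ.+ f) ∎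
    where
      open ≡-Reasoning
      lemma : ∀ e f m → e ℕ.+ 2 ℕ.* f ℕ.+ 2 ℕ.* m ≡ e ℕ.+ 2 ℕ.* (m ℕ.+ f)
      lemma = ℕ-Solver.solve-∀

  module _ {n K : ℕ} (S : Scenarios n K) where

    Type : Set
    Type = Vec Bool K

    type : Fin n → Type
    type j = tabulate (λ k → lookup (S k) j)

    open Enumeration _≟ᵥ_ (allVectors K) allVectors-once

    perType : (Fin n → ℤ) → Type → ℤ
    perType w t = ∑ (λ j → 𝟙 (type j ≟ᵥ t) * w j) (allFin n)

    perType-cong : ∀ {v w} → (∀ j → v j ≡ w j) → ∀ t → perType v t ≡ perType w t
    perType-cong v≡w t = ∑-cong (λ j → cong (𝟙 (type j ≟ᵥ t) *_) (v≡w j)) (allFin n)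

    perType-+ : ∀ v w t → perType (λ j → v j + w j) t ≡ perType v t + perType w t
    perType-+ v w t = trans (∑-cong (λ j → ℤₚ.*-distribˡ-+ (𝟙 (type j ≟ᵥ t)) (v j) (w j)) (allFin n)) (∑-+ _ _ (allFin n))

    perType-difference : ∀ v w t → perType (λ j → v j - w j) t ≡ perType v t - perType w t
    perType-difference v w t = trans (∑-cong (λ j → lemma (𝟙 (type j ≟ᵥ t)) (v j) (w j)) (allFin n)) (∑-difference _ _ (allFin n))
      where lemma : ∀ c a b → c * (a - b) ≡ c * a - c * b
            lemma = solve-∀

    ∑-scenario-byType : ∀ k (w : Fin n → ℤ) →
      ∑ (λ j → inScenario S k j * w j) (allFin n) ≡ ∑ (λ t → bit (lookup t k) * perType w t) (allVectors K)
    ∑-scenario-byType k w = trans (∑-byType type (λ j → inScenario S k j * w j) (allFin n))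
      (∑-cong (λ t → trans (∑-cong (move t) (allFin n)) (∑-*ˡ (bit (lookup t k)) (λ j → 𝟙 (type j ≟ᵥ t) * w j) (allFin n))) (allVectors K))
      where
        move : ∀ t j → 𝟙 (type j ≟ᵥ t) * (inScenario S k j * w j) ≡ bit (lookup t k) * (𝟙 (type j ≟ᵥ t) * w j)
        move t j = begin
          𝟙 (type j ≟ᵥ t) * (inScenario S k j * w j)
            ≡⟨ cong (λ b → 𝟙 (type j ≟ᵥ t) * (bit b * w j)) (Vecₚ.lookup∘tabulate (λ k → lookup (S k) j) k) ⟨
          𝟙 (type j ≟ᵥ t) * (bit (lookup (type j) k) * w j) ≡⟨ 𝟙-subst (λ u → bit (lookup u k) * w j) (type j) t ⟩
          𝟙 (type j ≟ᵥ t) * (bit (lookup t k) * w j)        ≡⟨ lemma (𝟙 (type j ≟ᵥ t)) (bit (lookup t k)) (w j) ⟩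
          bit (lookup t k) * (𝟙 (type j ≟ᵥ t) * w j)        ∎
          where
            open ≡-Reasoning
            lemma : ∀ a b c → a * (b * c) ≡ b * (a * c)
            lemma = solve-∀

    ∣∑-byType∣≤ : ∀ k (F : Type → ℤ) {B} → (∀ t → ∣ F t ∣ ℕ.≤ B) →
                  ∣ ∑ (λ t → bit (lookup t k) * F t) (allVectors K) ∣ ℕ.≤ 2 ℕ.^ K ℕ.* B
    ∣∑-byType∣≤ k F {B} ∣F∣≤B =
      subst (λ l → ∣ ∑ f (allVectors K) ∣ ℕ.≤ l ℕ.* B) (length-allVectors K) (∣∑∣≤ f B term≤ (allVectors K))
      where
        f = λ t → bit (lookup t k) * F t
        term≤ : ∀ t → ∣ bit (lookup t k) * F t ∣ ℕ.≤ B
        term≤ t = ℕₚ.≤-trans (∣bit*i∣≤∣i∣ (lookup t k) (F t)) (∣F∣≤B t)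

    excess : Assignment n → Type → ℤ
    excess ψ = perType (σ ∘ ψ)

    prefixExcess : Assignment n → Fin n → Type → ℤ
    prefixExcess ψ j₀ = perType (λ j → 𝟙 (j ≤? j₀) * σ (ψ j))

    discrepancy-byType : ∀ ψ k → discrepancy S ψ k ≡ ∑ (λ t → bit (lookup t k) * excess ψ t) (allVectors K)
    discrepancy-byType ψ k = ∑-scenario-byType k (σ ∘ ψ)

    prefixDiscrepancy-byType : ∀ ψ j₀ k → prefixDiscrepancy S ψ j₀ k ≡ ∑ (λ t → bit (lookup t k) * prefixExcess ψ j₀ t) (allVectors K)
    prefixDiscrepancy-byType ψ j₀ k = ∑-scenario-byType k (λ j → 𝟙 (j ≤? j₀) * σ (ψ j))

    count : Type → ℕ
    count = JobScan.occurrences (_≟ᵥ_ {K}) type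

    module Scheduled (schedule : Type → ℕ → Fin 2) where
      open JobScan (_≟ᵥ_ {K})

      ψ : Assignment n
      ψ = assign schedule type (λ _ → 0)

      excess-ψ : ∀ t → excess ψ t ≡ walk (schedule t) (count t)
      excess-ψ t = trans (assign-total schedule type (λ _ → 0) t) (ℤₚ.+-identityʳ _)

      prefixExcess-ψ : ∀ j₀ t → ∃ λ m → prefixExcess ψ j₀ t ≡ walk (schedule t) m
      prefixExcess-ψ j₀ t with m , run ← assign-prefix schedule type (λ _ → 0) t j₀ = m , trans run (ℤₚ.+-identityʳ _)

    -- Alternating within every type, as a benchmark for the discrepancies of an optimal assignment.
    module Benchmark = Scheduled (λ _ → alternating)

    ∣discrepancy-benchmark∣≤ : ∀ k → ∣ discrepancy S Benchmark.ψ k ∣ ℕ.≤ 2 ℕ.^ K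
    ∣discrepancy-benchmark∣≤ k = subst (λ d → ∣ d ∣ ℕ.≤ 2 ℕ.^ K) (sym (discrepancy-byType Benchmark.ψ k))
      (ℕₚ.≤-trans (∣∑-byType∣≤ k (excess Benchmark.ψ) ∣excess∣≤1) (ℕₚ.≤-reflexive (ℕₚ.*-identityʳ _)))
      where
        ∣excess∣≤1 : ∀ t → ∣ excess Benchmark.ψ t ∣ ℕ.≤ 1
        ∣excess∣≤1 t = subst (λ e → ∣ e ∣ ℕ.≤ 1) (sym (Benchmark.excess-ψ t)) (∣walk-alternating∣≤1 (count t))

    ∑discrepancy²-benchmark≤ : ∑discrepancy² S Benchmark.ψ ≤ + (K ℕ.* (2 ℕ.^ K ℕ.* 2 ℕ.^ K))
    ∑discrepancy²-benchmark≤ = ∣i∣≤n⇒i≤n (subst (λ l → ∣ ∑discrepancy² S Benchmark.ψ ∣ ℕ.≤ l ℕ.* (2 ℕ.^ K ℕ.* 2 ℕ.^ K))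
      (Listₚ.length-tabulate {n = K} (λ k → k)) (∣∑∣≤ (λ k → d k * d k) (2 ℕ.^ K ℕ.* 2 ℕ.^ K) ∣d²∣≤ (allFin K)))
      where
        d = discrepancy S Benchmark.ψ
        ∣d²∣≤ : ∀ k → ∣ d k * d k ∣ ℕ.≤ 2 ℕ.^ K ℕ.* 2 ℕ.^ K
        ∣d²∣≤ k = subst (ℕ._≤ _) (sym (ℤₚ.∣i*j∣≡∣i∣*∣j∣ (d k) (d k)))
                    (ℕₚ.*-mono-≤ (∣discrepancy-benchmark∣≤ k) (∣discrepancy-benchmark∣≤ k))

    ∣discrepancy-optimal∣≤ : ∀ {φ} → IsOptimal S φ → ∀ k → ∣ discrepancy S φ k ∣ ℕ.≤ K ℕ.* (2 ℕ.^ K ℕ.* 2 ℕ.^ K)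
    ∣discrepancy-optimal∣≤ {φ} opt k = ℕₚ.≤-trans (n≤n*n ∣ d ∣) (ℤₚ.drop‿+≤+ (begin
      + (∣ d ∣ ℕ.* ∣ d ∣)            ≡⟨ i*i≡+∣i∣*∣i∣ d ⟨
      d * d                          ≤⟨ term≤∑ (λ k → discrepancy S φ k * discrepancy S φ k) (square≥0 ∘ discrepancy S φ) (∈-allFin k) ⟩
      ∑discrepancy² S φ              ≤⟨ ∑discrepancy²-mono S φ Benchmark.ψ (opt Benchmark.ψ) ⟩
      ∑discrepancy² S Benchmark.ψ    ≤⟨ ∑discrepancy²-benchmark≤ ⟩
      + (K ℕ.* (2 ℕ.^ K ℕ.* 2 ℕ.^ K)) ∎))
      where
        open ℤₚ.≤-Reasoning
        d = discrepancy S φ k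
        square≥0 : ∀ i → 0ℤ ≤ i * i
        square≥0 i = subst (0ℤ ≤_) (sym (i*i≡+∣i∣*∣i∣ i)) (ℤ.+≤+ z≤n)

    module Rebalancing {φ : Assignment n} (opt : IsOptimal S φ) where

      onMachine : Fin 2 → Type → ℕ
      onMachine i t = length (filter (λ j → type j ≟ᵥ t ×-dec φ j ≟ i) (allFin n))

      +onMachine : ∀ i t → + onMachine i t ≡ perType (λ j → 𝟙 (φ j ≟ i)) t
      +onMachine i t = trans (+length-filter _ (allFin n)) (∑-cong (λ j → 𝟙-× (type j ≟ᵥ t) (φ j ≟ i)) (allFin n))

      x y : Type → ℕ
      x = onMachine zero
      y = onMachine (suc zero)

      excess-φ : ∀ t → excess φ t ≡ + x t - + y t
      excess-φ t = begin
        perType (σ ∘ φ) t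
          ≡⟨ perType-cong (λ j → sym (𝟙-machine-difference (φ j))) t ⟩
        perType (λ j → 𝟙 (φ j ≟ zero) - 𝟙 (φ j ≟ suc zero)) t
          ≡⟨ perType-difference (λ j → 𝟙 (φ j ≟ zero)) (λ j → 𝟙 (φ j ≟ suc zero)) t ⟩
        perType (λ j → 𝟙 (φ j ≟ zero)) t - perType (λ j → 𝟙 (φ j ≟ suc zero)) t
          ≡⟨ cong₂ _-_ (+onMachine zero t) (+onMachine (suc zero) t) ⟨
        + x t - + y t ∎
        where open ≡-Reasoning

      count≡x+y : ∀ t → count t ≡ x t ℕ.+ y t
      count≡x+y t = ℤₚ.+-injective (begin
        + count t                                  ≡⟨ JobScan.+occurrences (_≟ᵥ_ {K}) type t ⟩
        ∑ (λ j → 𝟙 (type j ≟ᵥ t)) (allFin n)       ≡⟨ ∑-cong (λ j → sym (ℤₚ.*-identityʳ (𝟙 (type j ≟ᵥ t)))) (allFin n) ⟩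
        perType (λ _ → 1ℤ) t                        ≡⟨ perType-cong (λ j → sym (𝟙-machine-sum (φ j))) t ⟩
        perType (λ j → 𝟙 (φ j ≟ zero) + 𝟙 (φ j ≟ suc zero)) t
          ≡⟨ perType-+ (λ j → 𝟙 (φ j ≟ zero)) (λ j → 𝟙 (φ j ≟ suc zero)) t ⟩
        perType (λ j → 𝟙 (φ j ≟ zero)) t + perType (λ j → 𝟙 (φ j ≟ suc zero)) t
          ≡⟨ cong₂ _+_ (+onMachine zero t) (+onMachine (suc zero) t) ⟨
        + (x t ℕ.+ y t)                            ∎)
        where open ≡-Reasoning

      gap half parity : Type → ℕ
      gap t = ℕ.∣ x t - y t ∣
      half t = gap t / 2
      parity t = gap t % 2

      gap≡ : ∀ t → gap t ≡ parity t ℕ.+ half t ℕ.* 2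
      gap≡ t = m≡m%n+[m/n]*n (gap t) 2

      heavy : Type → Fin 2
      heavy t = heavier (x t) (y t)

      excess-φ≡ : ∀ t → excess φ t ≡ + gap t * σ (heavy t)
      excess-φ≡ t = trans (excess-φ t) (difference-heavier (x t) (y t))

      direction : Type → Fin K → ℤ
      direction t k = σ (heavy t) * bit (lookup t k)

      ∣direction∣≤1 : ∀ t k → ∣ direction t k ∣ ℕ.≤ 1
      ∣direction∣≤1 t k = subst (ℕ._≤ 1) (sym (∣σ*i∣≡∣i∣ (heavy t) (bit (lookup t k)))) (∣bit∣≤1 (lookup t k))

      -- Each copy of t in pairs stands for one job of type t that can move from its heavier to its lighter
      -- machine, changing the discrepancies by -2 direction t; a zero-sum collection of copies can all move.
      pairs : List Type
      pairs = concatMap (λ t → replicate (half t) t) (allVectors K)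

      ∑-pairs : ∀ (g : Type → ℤ) → ∑ g pairs ≡ ∑ (λ t → + half t * g t) (allVectors K)
      ∑-pairs g = trans (∑-concatMap g (λ t → replicate (half t) t) (allVectors K))
                        (∑-cong (λ t → ∑-replicate g (half t) t) (allVectors K))

      leftoverParity : Fin K → ℤ
      leftoverParity k = ∑ (λ t → bit (lookup t k) * (σ (heavy t) * + parity t)) (allVectors K)

      2*∑-pairs : ∀ k → + 2 * ∑ (λ u → direction u k) pairs ≡ discrepancy S φ k - leftoverParity k
      2*∑-pairs k = begin
        + 2 * ∑ (λ u → direction u k) pairs
          ≡⟨ cong (+ 2 *_) (∑-pairs (λ u → direction u k)) ⟩
        + 2 * ∑ (λ t → + half t * direction t k) (allVectors K)
          ≡⟨ ∑-*ˡ (+ 2) _ (allVectors K) ⟨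
        ∑ (λ t → + 2 * (+ half t * direction t k)) (allVectors K)
          ≡⟨ ∑-cong per-type (allVectors K) ⟩
        ∑ (λ t → bit (lookup t k) * excess φ t - bit (lookup t k) * (σ (heavy t) * + parity t)) (allVectors K)
          ≡⟨ ∑-difference _ _ (allVectors K) ⟩
        ∑ (λ t → bit (lookup t k) * excess φ t) (allVectors K) - leftoverParity k
          ≡⟨ cong (_- leftoverParity k) (discrepancy-byType φ k) ⟨
        discrepancy S φ k - leftoverParity k ∎
        where
          open ≡-Reasoning
          per-type : ∀ t → + 2 * (+ half t * direction t k) ≡ bit (lookup t k) * excess φ t - bit (lookup t k) * (σ (heavy t) * + parity t)
          per-type t = begin
            + 2 * (+ half t * (σ (heavy t) * bit (lookup t k)))
              ≡⟨ lemma (+ half t) (σ (heavy t)) (bit (lookup t k)) (+ parity t) ⟩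
            bit (lookup t k) * ((+ parity t + + half t * + 2) * σ (heavy t)) - bit (lookup t k) * (σ (heavy t) * + parity t)
              ≡⟨ cong (λ g → bit (lookup t k) * (g * σ (heavy t)) - bit (lookup t k) * (σ (heavy t) * + parity t))
                      gap-cast ⟩
            bit (lookup t k) * (+ gap t * σ (heavy t)) - bit (lookup t k) * (σ (heavy t) * + parity t)
              ≡⟨ cong (λ e → bit (lookup t k) * e - bit (lookup t k) * (σ (heavy t) * + parity t)) (excess-φ≡ t) ⟨
            bit (lookup t k) * excess φ t - bit (lookup t k) * (σ (heavy t) * + parity t) ∎
            where
              lemma : ∀ h s b p → + 2 * (h * (s * b)) ≡ b * ((p + h * + 2) * s) - b * (s * p)
              lemma = solve-∀
              gap-cast : + parity t + + half t * + 2 ≡ + gap t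
              gap-cast = trans (cong (λ h → + parity t + h) (sym (ℤₚ.pos-* (half t) 2)))
                               (trans (sym (ℤₚ.pos-+ (parity t) (half t ℕ.* 2))) (cong +_ (sym (gap≡ t))))

      ∣leftoverParity∣≤ : ∀ k → ∣ leftoverParity k ∣ ℕ.≤ 2 ℕ.^ K
      ∣leftoverParity∣≤ k = ℕₚ.≤-trans (∣∑-byType∣≤ k (λ t → σ (heavy t) * + parity t) bound) (ℕₚ.≤-reflexive (ℕₚ.*-identityʳ _))
        where
          bound : ∀ t → ∣ σ (heavy t) * + parity t ∣ ℕ.≤ 1
          bound t = subst (ℕ._≤ 1) (sym (∣σ*i∣≡∣i∣ (heavy t) (+ parity t))) (ℕₚ.<⇒≤pred (m%n<n (gap t) 2))

      ∣∑-pairs∣≤ : ∀ k → ∣ ∑ (λ u → direction u k) pairs ∣ ℕ.≤ discrepancyBound K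
      ∣∑-pairs∣≤ k = begin
        ∣ s ∣                                                 ≤⟨ ℕₚ.m≤n*m ∣ s ∣ 2 ⟩
        2 ℕ.* ∣ s ∣                                           ≡⟨ ℤₚ.∣i*j∣≡∣i∣*∣j∣ (+ 2) s ⟨
        ∣ + 2 * s ∣                                           ≡⟨ cong ∣_∣ (2*∑-pairs k) ⟩
        ∣ discrepancy S φ k - leftoverParity k ∣             ≤⟨ ℤₚ.∣i-j∣≤∣i∣+∣j∣ (discrepancy S φ k) (leftoverParity k) ⟩
        ∣ discrepancy S φ k ∣ ℕ.+ ∣ leftoverParity k ∣       ≤⟨ ℕₚ.+-mono-≤ (∣discrepancy-optimal∣≤ opt k) (∣leftoverParity∣≤ k) ⟩
        discrepancyBound K                                    ∎
        where
          open ℕₚ.≤-Reasoning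
          s = ∑ (λ u → direction u k) pairs

      restBound : ℕ
      restBound = decompositionBound K 1 (discrepancyBound K)

      open ZeroSumDecomposition (zeroSumDecomposition K 1 (discrepancyBound K) direction ∣direction∣≤1 pairs ∣∑-pairs∣≤)

      copies : List Type → Type → ℕ
      copies us t = length (filter (_≟ᵥ t) us)

      +copies : ∀ us t → + copies us t ≡ ∑ (λ u → 𝟙 (u ≟ᵥ t)) us
      +copies us t = +length-filter (_≟ᵥ t) us

      moved kept : Type → ℕ
      moved = copies zeroPart
      kept = copies rest

      half≡moved+kept : ∀ t → half t ≡ moved t ℕ.+ kept t
      half≡moved+kept t = ℤₚ.+-injective (begin
        + half t                                       ≡⟨ ∑-collapse′ (λ u → + half u) t ⟨
        ∑ (λ u → 𝟙 (u ≟ᵥ t) * + half u) (allVectors K) ≡⟨ ∑-cong (λ u → ℤₚ.*-comm (𝟙 (u ≟ᵥ t)) (+ half u)) (allVectors K) ⟩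
        ∑ (λ u → + half u * 𝟙 (u ≟ᵥ t)) (allVectors K) ≡⟨ ∑-pairs (λ u → 𝟙 (u ≟ᵥ t)) ⟨
        ∑ (λ u → 𝟙 (u ≟ᵥ t)) pairs                     ≡⟨ ∑-↭ (λ u → 𝟙 (u ≟ᵥ t)) perm ⟩
        ∑ (λ u → 𝟙 (u ≟ᵥ t)) (zeroPart ++ rest)        ≡⟨ ∑-++ (λ u → 𝟙 (u ≟ᵥ t)) zeroPart rest ⟩
        ∑ (λ u → 𝟙 (u ≟ᵥ t)) zeroPart + ∑ (λ u → 𝟙 (u ≟ᵥ t)) rest ≡⟨ cong₂ _+_ (+copies zeroPart t) (+copies rest t) ⟨
        + (moved t ℕ.+ kept t)                         ∎)
        where open ≡-Reasoning

      kept≤restBound : ∀ t → kept t ℕ.≤ restBound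
      kept≤restBound t = ℕₚ.≤-trans (Listₚ.length-filter (_≟ᵥ t) rest) small-rest

      moved-balanced : ∀ k → ∑ (λ t → bit (lookup t k) * (σ (heavy t) * + moved t)) (allVectors K) ≡ 0ℤ
      moved-balanced k = begin
        ∑ (λ t → bit (lookup t k) * (σ (heavy t) * + moved t)) (allVectors K)
          ≡⟨ ∑-cong (λ t → lemma (bit (lookup t k)) (σ (heavy t)) (+ moved t)) (allVectors K) ⟩
        ∑ (λ t → + moved t * direction t k) (allVectors K)
          ≡⟨ ∑-cong (λ t → cong (_* direction t k) (+copies zeroPart t)) (allVectors K) ⟩
        ∑ (λ t → ∑ (λ u → 𝟙 (u ≟ᵥ t)) zeroPart * direction t k) (allVectors K)
          ≡⟨ ∑-cong (λ t → trans (ℤₚ.*-comm _ (direction t k)) (sym (∑-*ˡ (direction t k) _ zeroPart))) (allVectors K) ⟩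
        ∑ (λ t → ∑ (λ u → direction t k * 𝟙 (u ≟ᵥ t)) zeroPart) (allVectors K)
          ≡⟨ ∑-comm (λ t u → direction t k * 𝟙 (u ≟ᵥ t)) (allVectors K) zeroPart ⟩
        ∑ (λ u → ∑ (λ t → direction t k * 𝟙 (u ≟ᵥ t)) (allVectors K)) zeroPart
          ≡⟨ ∑-cong (λ u → trans (∑-cong (λ t → ℤₚ.*-comm (direction t k) _) (allVectors K)) (∑-collapse (λ t → direction t k) u)) zeroPart ⟩
        ∑ (λ u → direction u k) zeroPart
          ≡⟨ zero-sum k ⟩
        0ℤ ∎
        where
          open ≡-Reasoning
          lemma : ∀ b s m → b * (s * m) ≡ m * (s * b)
          lemma = solve-∀

      newExcess : Type → ℕ
      newExcess t = gap t ℕ.∸ 2 ℕ.* moved t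

      gap≡newExcess+2*moved : ∀ t → gap t ≡ (parity t ℕ.+ kept t ℕ.* 2) ℕ.+ 2 ℕ.* moved t
      gap≡newExcess+2*moved t = trans (gap≡ t) (trans (cong (λ h → parity t ℕ.+ h ℕ.* 2) (half≡moved+kept t)) (lemma (parity t) (moved t) (kept t)))
        where lemma : ∀ p m k → p ℕ.+ (m ℕ.+ k) ℕ.* 2 ≡ (p ℕ.+ k ℕ.* 2) ℕ.+ 2 ℕ.* m
              lemma = ℕ-Solver.solve-∀

      2*moved≤gap : ∀ t → 2 ℕ.* moved t ℕ.≤ gap t
      2*moved≤gap t = subst (2 ℕ.* moved t ℕ.≤_) (sym (gap≡newExcess+2*moved t)) (ℕₚ.m≤n+m (2 ℕ.* moved t) (parity t ℕ.+ kept t ℕ.* 2))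

      newExcess≡ : ∀ t → newExcess t ≡ parity t ℕ.+ kept t ℕ.* 2
      newExcess≡ t = trans (cong (ℕ._∸ 2 ℕ.* moved t) (gap≡newExcess+2*moved t)) (ℕₚ.m+n∸n≡m _ (2 ℕ.* moved t))

      -- Within type t: first the remaining excess on the heavier machine, then alternate.
      module New = Scheduled (λ t → leading (heavy t) (newExcess t))

      excess-new : ∀ t → excess New.ψ t ≡ excess φ t - + 2 * (σ (heavy t) * + moved t)
      excess-new t = begin
        excess New.ψ t                                              ≡⟨ New.excess-ψ t ⟩
        walk (leading (heavy t) (newExcess t)) (count t)            ≡⟨ cong (walk (leading (heavy t) (newExcess t))) count≡ ⟩
        walk (leading (heavy t) (newExcess t)) (newExcess t ℕ.+ 2 ℕ.* (x t ℕ.⊓ y t ℕ.+ moved t))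
                                                                    ≡⟨ walk-leading (heavy t) (newExcess t) (x t ℕ.⊓ y t ℕ.+ moved t) ⟩
        + newExcess t * σ (heavy t)                                 ≡⟨ cong (_* σ (heavy t)) (+[m∸n]≡+m-+n (2*moved≤gap t)) ⟩
        (+ gap t - + (2 ℕ.* moved t)) * σ (heavy t)                 ≡⟨ cong (λ m → (+ gap t - m) * σ (heavy t)) (ℤₚ.pos-* 2 (moved t)) ⟩
        (+ gap t - + 2 * + moved t) * σ (heavy t)                   ≡⟨ lemma (+ gap t) (+ moved t) (σ (heavy t)) ⟩
        + gap t * σ (heavy t) - + 2 * (σ (heavy t) * + moved t)     ≡⟨ cong (_- + 2 * (σ (heavy t) * + moved t)) (excess-φ≡ t) ⟨
        excess φ t - + 2 * (σ (heavy t) * + moved t)                ∎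
        where
          open ≡-Reasoning
          count≡ : count t ≡ newExcess t ℕ.+ 2 ℕ.* (x t ℕ.⊓ y t ℕ.+ moved t)
          count≡ = trans (count≡x+y t) (moved-split (x t) (y t) (moved t) (2*moved≤gap t))
          lemma : ∀ g m s → (g - + 2 * m) * s ≡ g * s - + 2 * (s * m)
          lemma = solve-∀

      discrepancy-new : ∀ k → discrepancy S New.ψ k ≡ discrepancy S φ k
      discrepancy-new k = begin
        discrepancy S New.ψ k
          ≡⟨ discrepancy-byType New.ψ k ⟩
        ∑ (λ t → bit (lookup t k) * excess New.ψ t) (allVectors K)
          ≡⟨ ∑-cong (λ t → trans (cong (bit (lookup t k) *_) (excess-new t)) (lemma (bit (lookup t k)) (excess φ t) (σ (heavy t) * + moved t))) (allVectors K) ⟩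
        ∑ (λ t → bit (lookup t k) * excess φ t - + 2 * (bit (lookup t k) * (σ (heavy t) * + moved t))) (allVectors K)
          ≡⟨ ∑-difference _ _ (allVectors K) ⟩
        ∑ (λ t → bit (lookup t k) * excess φ t) (allVectors K) - ∑ (λ t → + 2 * (bit (lookup t k) * (σ (heavy t) * + moved t))) (allVectors K)
          ≡⟨ cong₂ _-_ (sym (discrepancy-byType φ k)) (trans (∑-*ˡ (+ 2) _ (allVectors K)) (cong (+ 2 *_) (moved-balanced k))) ⟩
        discrepancy S φ k - + 2 * 0ℤ
          ≡⟨ ℤₚ.+-identityʳ (discrepancy S φ k) ⟩
        discrepancy S φ k ∎
        where
          open ≡-Reasoning
          lemma : ∀ b e m → b * (e - + 2 * m) ≡ b * e - + 2 * (b * m)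
          lemma = solve-∀

      optimal-new : IsOptimal S New.ψ
      optimal-new ψ′ = subst (ℕ._≤ totalCost S ψ′) (sym (totalCost-cong S φ New.ψ discrepancy-new)) (opt ψ′)

      ∣prefixExcess-new∣≤ : ∀ j t → ∣ prefixExcess New.ψ j t ∣ ℕ.≤ 2 ℕ.* restBound ℕ.+ 2
      ∣prefixExcess-new∣≤ j t = bound (New.prefixExcess-ψ j t)
       where
        bound : (∃ λ m → prefixExcess New.ψ j t ≡ walk (leading (heavy t) (newExcess t)) m) → ∣ prefixExcess New.ψ j t ∣ ℕ.≤ 2 ℕ.* restBound ℕ.+ 2
        bound (m , run) = begin
          ∣ prefixExcess New.ψ j t ∣                          ≡⟨ cong ∣_∣ run ⟩
          ∣ walk (leading (heavy t) (newExcess t)) m ∣         ≤⟨ ∣walk-leading∣≤ (heavy t) (newExcess t) m ⟩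
          suc (newExcess t)                                    ≡⟨ cong suc (newExcess≡ t) ⟩
          suc (parity t ℕ.+ kept t ℕ.* 2)
            ≤⟨ s≤s (ℕₚ.+-mono-≤ (ℕₚ.<⇒≤pred (m%n<n (gap t) 2)) (ℕₚ.*-monoˡ-≤ 2 (kept≤restBound t))) ⟩
          suc (1 ℕ.+ restBound ℕ.* 2)                          ≡⟨ lemma restBound ⟩
          2 ℕ.* restBound ℕ.+ 2                                ∎
          where
            open ℕₚ.≤-Reasoning
            lemma : ∀ r → suc (1 ℕ.+ r ℕ.* 2) ≡ 2 ℕ.* r ℕ.+ 2
            lemma = ℕ-Solver.solve-∀

      disbalance-new : fullDisbalance S New.ψ ℕ.≤ 2 ℕ.^ K ℕ.* (2 ℕ.* restBound ℕ.+ 2)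
      disbalance-new = fullDisbalance≤ S New.ψ bound
        where
          bound : ∀ j k → ∣ prefixDiscrepancy S New.ψ j k ∣ ℕ.≤ 2 ℕ.^ K ℕ.* (2 ℕ.* restBound ℕ.+ 2)
          bound j k = subst (λ d → ∣ d ∣ ℕ.≤ 2 ℕ.^ K ℕ.* (2 ℕ.* restBound ℕ.+ 2)) (sym (prefixDiscrepancy-byType New.ψ j k))
                        (∣∑-byType∣≤ k (prefixExcess New.ψ j) (∣prefixExcess-new∣≤ j))

proposition3 : Σ[ alg ∈ ((n K : ℕ) → (S : Scenarios n K) → (φ : Assignment n) → IsOptimal S φ → Assignment n) ]
                 ((n K : ℕ) → (S : Scenarios n K) → (φ : Assignment n) → (opt : IsOptimal S φ) →
                   IsOptimal S (alg n K S φ opt) × WithinBound K (fullDisbalance S (alg n K S φ opt)))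
proposition3 =
  (λ n K S φ opt → Rebalancing.New.ψ S opt) ,
  (λ n K S φ opt → Rebalancing.optimal-new S opt ,
                   withinBound K (Rebalancing.disbalance-new S opt))
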